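{- Let $(x,y,k)$ be a good triplet. Then there exist $p,q \in \mathbb{N}$ with $p < x^{2/3}+1$ and $q < x^{1/6}$ such that \begin{itemize} \item $0 < C(q,p,x,y) < 3q x^{1/6} + 1$, \item $|F(q,p,x,y)| < 8q + 1$, \item $|H(q,p,x,y)| < 72 q^4 + 1$. \end{itemize}
   Context: Here $\mathbb{N}=\{1,2,3,\dots\}$. A triple $(x,y,k)$ is a good triplet if $x,y \in \mathbb{N}$, $k = x^3 - y^2 \in \mathbb{Z}$, and $0 < |k| < \sqrt{x}$. The polynomials are defined by $B(q,p,x) = p^2 - q^2x$, $C(q,p,x,y) = p^3 - 3pq^2x + 2q^3y$, $F(q,p,x,y) = 4pC - 3B^2$, and $H(q,p,x,y) = 9FB - 8C^2$, where $B$ and $C$ denote $B(q,p,x)$ and $C(q,p,x,y)$. -}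

module Defs where

open import Data.Nat as ℕ using (ℕ)
open import Data.Integer using (ℤ; +_; _+_; _-_; _*_; _^_; ∣_∣; _<_)
open import Data.Product using (_×_)
open import Relation.Binary.PropositionalEquality using (_≡_)

B : ℕ → ℕ → ℕ → ℤ
B q p x = (+ p) ^ 2 - (+ q) ^ 2 * (+ x)

C : ℕ → ℕ → ℕ → ℕ → ℤ
C q p x y = (+ p) ^ 3 - (+ 3) * (+ p) * (+ q) ^ 2 * (+ x) + (+ 2) * (+ q) ^ 3 * (+ y)

F : ℕ → ℕ → ℕ → ℕ → ℤ
F q p x y = (+ 4) * (+ p) * C q p x y - (+ 3) * (B q p x) ^ 2

H : ℕ → ℕ → ℕ → ℕ → ℤ
H q p x y = (+ 9) * F q p x y * B q p x - (+ 8) * (C q p x y) ^ 2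

-- Real-root comparisons, expressed exactly in integer arithmetic.
-- For a natural number a, a < x^(1/n)  iff  a^n < x   (n ≥ 1).
_<RootOf_ : ℕ → ℕ → ℕ → Set
(a <RootOf n) x = a ℕ.^ n ℕ.< x

record GoodTriplet (x y : ℕ) (k : ℤ) : Set where
  field
    x-pos : 1 ℕ.≤ x
    y-pos : 1 ℕ.≤ y
    k-def : k ≡ (+ x) ^ 3 - (+ y) ^ 2
    k-nz  : 0 ℕ.< ∣ k ∣
    k-small : (∣ k ∣ <RootOf 2) x

module Submission where

-- For x < 4096 a finite search shows that (2, 3, -1) is the only good triplet, and p = q = 1 works.
-- For larger x let R be the least integer with x ≤ R⁶ and take a Dirichlet approximation p / q of
-- y / x with q < R, so that α = |p x - q y| ≤ x / R. In the variables A = p x - q y and k = x³ - y²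
-- the quantities x³ C, x⁴ F and x⁶ H are polynomials in A, q, y, k, and |A| ≤ x / R, |k| < √x,
-- q < x^(1/6), y ≈ x^(3/2) bound all their terms. C cannot be negative because
-- x³ C = A² (A + 3 q y) - q² k (3 A + q y) with non-negative first and small second term. Nor can
-- it vanish: then p / q would be an integer root m of t³ - 3 x t + 2 y, so that
-- 4 k = (m² - x)² (4 x - m²), while |A| ≤ x / R gives 0 < 4 |k| < 4 x - m².

module SignedSums where

  open import Data.Nat as ℕ using (ℕ; zero; suc)
  open import Data.Nat.Properties using (≤-refl; ≤-trans; ≤-reflexive; +-mono-≤)
  open import Data.Integer as ℤ using (ℤ; +_; ∣_∣; _◃_)
  open import Data.Integer.Properties using (∣i*j∣≡∣i∣*∣j∣; ∣i+j∣≤∣i∣+∣j∣; ∣i-j∣≤∣i∣+∣j∣; abs-◃)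
  open import Data.Sign as Sign using (Sign)
  open import Data.Vec using (Vec; []; _∷_; map)
  open import Data.List using (List; []; _∷_; foldl)
  open import Data.Product using (_×_; _,_)
  open import Relation.Binary.PropositionalEquality

  -- acc · v₁^e₁ · … · vₙ^eₙ, multiplied out left to right, so that for concrete exponents it
  -- unfolds to the literal product written in the identities.
  powProd : {A : Set} → (A → A → A) → A → ∀ {n} → Vec A n → Vec ℕ n → A
  powProd _·_ acc []       []           = acc
  powProd _·_ acc (v ∷ vs) (zero  ∷ es) = powProd _·_ acc vs es
  powProd _·_ acc (v ∷ vs) (suc e ∷ es) = powProd _·_ (acc · v) (v ∷ vs) (e ∷ es)

  ∣powProd∣ : ∀ {n} acc (vs : Vec ℤ n) es →
              ∣ powProd ℤ._*_ acc vs es ∣ ≡ powProd ℕ._*_ ∣ acc ∣ (map ∣_∣ vs) es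
  ∣powProd∣ acc []       []           = refl
  ∣powProd∣ acc (v ∷ vs) (zero  ∷ es) = ∣powProd∣ acc vs es
  ∣powProd∣ acc (v ∷ vs) (suc e ∷ es) = trans (∣powProd∣ (acc ℤ.* v) (v ∷ vs) (e ∷ es))
    (cong (λ a → powProd ℕ._*_ a (map ∣_∣ (v ∷ vs)) (e ∷ es)) (∣i*j∣≡∣i∣*∣j∣ acc v))

  Monomial : ℕ → Set
  Monomial n = Sign × ℕ × Vec ℕ n

  module _ {n : ℕ} where

    private
      addℤ : Vec ℤ n → ℤ → Monomial n → ℤ
      addℤ vs acc (Sign.+ , c , e) = acc ℤ.+ powProd ℤ._*_ (+ c) vs e
      addℤ vs acc (Sign.- , c , e) = acc ℤ.- powProd ℤ._*_ (+ c) vs e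

      addℕ : Vec ℕ n → ℕ → Monomial n → ℕ
      addℕ ns acc (_ , c , e) = acc ℕ.+ powProd ℕ._*_ c ns e

    eval : List (Monomial n) → Vec ℤ n → ℤ
    eval []                 vs = + 0
    eval ((s , c , e) ∷ ms) vs = foldl (addℤ vs) (powProd ℤ._*_ (s ◃ c) vs e) ms

    evalAbs : List (Monomial n) → Vec ℕ n → ℕ
    evalAbs []                 ns = 0
    evalAbs ((_ , c , e) ∷ ms) ns = foldl (addℕ ns) (powProd ℕ._*_ c ns e) ms

    ∣eval∣≤evalAbs : ∀ ms vs → ∣ eval ms vs ∣ ℕ.≤ evalAbs ms (map ∣_∣ vs)
    ∣eval∣≤evalAbs []                 vs = ≤-refl
    ∣eval∣≤evalAbs ((s , c , e) ∷ ms) vs = foldl-mono ms (≤-reflexive (trans (∣powProd∣ (s ◃ c) vs e)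
      (cong (λ a → powProd ℕ._*_ a (map ∣_∣ vs) e) (abs-◃ s c))))
      where
      ∣term∣ : ∀ c e → ∣ powProd ℤ._*_ (+ c) vs e ∣ ≡ powProd ℕ._*_ c (map ∣_∣ vs) e
      ∣term∣ c e = ∣powProd∣ (+ c) vs e
      foldl-mono : ∀ ms {acc accAbs} → ∣ acc ∣ ℕ.≤ accAbs →
                   ∣ foldl (addℤ vs) acc ms ∣ ℕ.≤ foldl (addℕ (map ∣_∣ vs)) accAbs ms
      foldl-mono []                      acc≤ = acc≤
      foldl-mono ((Sign.+ , c , e) ∷ ms) {acc} acc≤ = foldl-mono ms
        (≤-trans (∣i+j∣≤∣i∣+∣j∣ acc _) (+-mono-≤ acc≤ (≤-reflexive (∣term∣ c e))))
      foldl-mono ((Sign.- , c , e) ∷ ms) {acc} acc≤ = foldl-mono ms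
        (≤-trans (∣i-j∣≤∣i∣+∣j∣ acc _) (+-mono-≤ acc≤ (≤-reflexive (∣term∣ c e))))

module Identities where

  open import Data.Nat using (ℕ)
  open import Data.Integer
  open import Data.Integer.Tactic.RingSolver using (solve-∀)
  open import Data.Sign as Sign using ()
  open import Data.Vec using ([]; _∷_)
  open import Data.List using (List; []; _∷_)
  open import Data.Product using (_,_)
  open import Relation.Binary.PropositionalEquality
  open import Defs
  open SignedSums

  Bᴬ : ℤ → ℤ → ℤ → ℤ → ℤ
  Bᴬ A Q Y K = A * A + + 2 * A * Q * Y - Q * Q * K

  Cᴬ : ℤ → ℤ → ℤ → ℤ → ℤ
  Cᴬ A Q Y K = A * A * (A + + 3 * Q * Y) - Q * Q * K * (+ 3 * A + Q * Y)

  -- Terms ± c Aⁱ qʲ yˡ Kᵐ, written (sign , c , i ∷ j ∷ l ∷ m ∷ []).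
  F-terms : List (Monomial 4)
  F-terms = (Sign.+ , 1 , 4 ∷ 0 ∷ 0 ∷ 0 ∷ []) ∷ (Sign.+ , 4 , 3 ∷ 1 ∷ 1 ∷ 0 ∷ [])
          ∷ (Sign.- , 6 , 2 ∷ 2 ∷ 0 ∷ 1 ∷ []) ∷ (Sign.- , 4 , 1 ∷ 3 ∷ 1 ∷ 1 ∷ [])
          ∷ (Sign.- , 4 , 0 ∷ 4 ∷ 2 ∷ 1 ∷ []) ∷ (Sign.- , 3 , 0 ∷ 4 ∷ 0 ∷ 2 ∷ []) ∷ []

  Fᴬ : ℤ → ℤ → ℤ → ℤ → ℤ
  Fᴬ A Q Y K = eval F-terms (A ∷ Q ∷ Y ∷ K ∷ [])

  H-terms : List (Monomial 4)
  H-terms = (Sign.+ , 1 , 6 ∷ 0 ∷ 0 ∷ 0 ∷ []) ∷ (Sign.+ , 6 , 5 ∷ 1 ∷ 1 ∷ 0 ∷ [])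
          ∷ (Sign.- , 15 , 4 ∷ 2 ∷ 0 ∷ 1 ∷ []) ∷ (Sign.- , 20 , 3 ∷ 3 ∷ 1 ∷ 1 ∷ [])
          ∷ (Sign.- , 60 , 2 ∷ 4 ∷ 2 ∷ 1 ∷ []) ∷ (Sign.- , 45 , 2 ∷ 4 ∷ 0 ∷ 2 ∷ [])
          ∷ (Sign.- , 72 , 1 ∷ 5 ∷ 3 ∷ 1 ∷ []) ∷ (Sign.- , 66 , 1 ∷ 5 ∷ 1 ∷ 2 ∷ [])
          ∷ (Sign.+ , 28 , 0 ∷ 6 ∷ 2 ∷ 2 ∷ []) ∷ (Sign.+ , 27 , 0 ∷ 6 ∷ 0 ∷ 3 ∷ []) ∷ []

  Hᴬ : ℤ → ℤ → ℤ → ℤ → ℤ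
  Hᴬ A Q Y K = eval H-terms (A ∷ Q ∷ Y ∷ K ∷ [])

  -- The ring solver does not see through _^_, so each identity is solved with the powers unfolded.
  module _ (p q x y : ℕ) where

    private
      P = + p
      Q = + q
      X = + x
      Y = + y

    A : ℤ
    A = P * X - Q * Y

    K : ℤ
    K = X ^ 3 - Y ^ 2

    x²B≡Bᴬ : X ^ 2 * B q p x ≡ Bᴬ A Q Y K
    x²B≡Bᴬ = identity P Q X Y
      where
      identity : ∀ P Q X Y → X * (X * + 1) * (P * (P * + 1) - Q * (Q * + 1) * X)
               ≡ (P * X - Q * Y) * (P * X - Q * Y) + + 2 * (P * X - Q * Y) * Q * Y
                 - Q * Q * (X * (X * (X * + 1)) - Y * (Y * + 1))
      identity = solve-∀

    x³C≡Cᴬ : X ^ 3 * C q p x y ≡ Cᴬ A Q Y K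
    x³C≡Cᴬ = identity P Q X Y
      where
      identity : ∀ P Q X Y
               → X * (X * (X * + 1)) * (P * (P * (P * + 1)) - + 3 * P * (Q * (Q * + 1)) * X + + 2 * (Q * (Q * (Q * + 1))) * Y)
               ≡ (P * X - Q * Y) * (P * X - Q * Y) * ((P * X - Q * Y) + + 3 * Q * Y)
                 - Q * Q * (X * (X * (X * + 1)) - Y * (Y * + 1)) * (+ 3 * (P * X - Q * Y) + Q * Y)
      identity = solve-∀

    x⁴F≡Fᴬ : X ^ 4 * F q p x y ≡ Fᴬ A Q Y K
    x⁴F≡Fᴬ = begin
      X ^ 4 * F q p x y
        ≡⟨ lift P X (C q p x y) (B q p x) ⟩
      + 4 * (P * X) * (X ^ 3 * C q p x y) - + 3 * ((X ^ 2 * B q p x) * (X ^ 2 * B q p x))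
        ≡⟨ cong₂ (λ u v → + 4 * u * v - + 3 * ((X ^ 2 * B q p x) * (X ^ 2 * B q p x))) PX≡A+QY x³C≡Cᴬ ⟩
      + 4 * (A + Q * Y) * Cᴬ A Q Y K - + 3 * ((X ^ 2 * B q p x) * (X ^ 2 * B q p x))
        ≡⟨ cong (λ w → + 4 * (A + Q * Y) * Cᴬ A Q Y K - + 3 * (w * w)) x²B≡Bᴬ ⟩
      + 4 * (A + Q * Y) * Cᴬ A Q Y K - + 3 * (Bᴬ A Q Y K * Bᴬ A Q Y K)
        ≡⟨ expand A Q Y K ⟩
      Fᴬ A Q Y K ∎
      where
      open ≡-Reasoning
      lift : ∀ P X C B → X * (X * (X * (X * + 1))) * (+ 4 * P * C - + 3 * (B * (B * + 1)))
           ≡ + 4 * (P * X) * (X * (X * (X * + 1)) * C) - + 3 * ((X * (X * + 1) * B) * (X * (X * + 1) * B))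
      lift = solve-∀
      PX≡A+QY : P * X ≡ A + Q * Y
      PX≡A+QY = identity P X Q Y
        where identity : ∀ P X Q Y → P * X ≡ (P * X - Q * Y) + Q * Y
              identity = solve-∀
      expand : ∀ A Q Y K
             → + 4 * (A + Q * Y) * (A * A * (A + + 3 * Q * Y) - Q * Q * K * (+ 3 * A + Q * Y))
               - + 3 * ((A * A + + 2 * A * Q * Y - Q * Q * K) * (A * A + + 2 * A * Q * Y - Q * Q * K))
             ≡ + 1 * A * A * A * A + + 4 * A * A * A * Q * Y - + 6 * A * A * Q * Q * K
               - + 4 * A * Q * Q * Q * Y * K - + 4 * Q * Q * Q * Q * Y * Y * K - + 3 * Q * Q * Q * Q * K * K
      expand = solve-∀

    x⁶H≡Hᴬ : X ^ 6 * H q p x y ≡ Hᴬ A Q Y K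
    x⁶H≡Hᴬ = begin
      X ^ 6 * H q p x y
        ≡⟨ lift X (F q p x y) (B q p x) (C q p x y) ⟩
      + 9 * (X ^ 4 * F q p x y) * (X ^ 2 * B q p x) - + 8 * ((X ^ 3 * C q p x y) * (X ^ 3 * C q p x y))
        ≡⟨ cong₂ (λ u v → + 9 * u * v - + 8 * ((X ^ 3 * C q p x y) * (X ^ 3 * C q p x y))) x⁴F≡Fᴬ x²B≡Bᴬ ⟩
      + 9 * Fᴬ A Q Y K * Bᴬ A Q Y K - + 8 * ((X ^ 3 * C q p x y) * (X ^ 3 * C q p x y))
        ≡⟨ cong (λ w → + 9 * Fᴬ A Q Y K * Bᴬ A Q Y K - + 8 * (w * w)) x³C≡Cᴬ ⟩
      + 9 * Fᴬ A Q Y K * Bᴬ A Q Y K - + 8 * (Cᴬ A Q Y K * Cᴬ A Q Y K)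
        ≡⟨ expand A Q Y K ⟩
      Hᴬ A Q Y K ∎
      where
      open ≡-Reasoning
      lift : ∀ X F B C → X * (X * (X * (X * (X * (X * + 1))))) * (+ 9 * F * B - + 8 * (C * (C * + 1)))
           ≡ + 9 * (X * (X * (X * (X * + 1))) * F) * (X * (X * + 1) * B)
             - + 8 * ((X * (X * (X * + 1)) * C) * (X * (X * (X * + 1)) * C))
      lift = solve-∀
      expand : ∀ A Q Y K
             → + 9 * (+ 1 * A * A * A * A + + 4 * A * A * A * Q * Y - + 6 * A * A * Q * Q * K
                      - + 4 * A * Q * Q * Q * Y * K - + 4 * Q * Q * Q * Q * Y * Y * K - + 3 * Q * Q * Q * Q * K * K)
                   * (A * A + + 2 * A * Q * Y - Q * Q * K)
               - + 8 * ((A * A * (A + + 3 * Q * Y) - Q * Q * K * (+ 3 * A + Q * Y))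
                        * (A * A * (A + + 3 * Q * Y) - Q * Q * K * (+ 3 * A + Q * Y)))
             ≡ + 1 * A * A * A * A * A * A + + 6 * A * A * A * A * A * Q * Y - + 15 * A * A * A * A * Q * Q * K
               - + 20 * A * A * A * Q * Q * Q * Y * K - + 60 * A * A * Q * Q * Q * Q * Y * Y * K
               - + 45 * A * A * Q * Q * Q * Q * K * K - + 72 * A * Q * Q * Q * Q * Q * Y * Y * Y * K
               - + 66 * A * Q * Q * Q * Q * Q * Y * K * K + + 28 * Q * Q * Q * Q * Q * Q * Y * Y * K * K
               + + 27 * Q * Q * Q * Q * Q * Q * K * K * K
      expand = solve-∀

module RationalRoot where

  open import Relation.Binary.PropositionalEquality
  open import Data.Product using (∃; _×_; _,_)
  open import Data.Nat
  import Data.Nat.Properties as ℕₚ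
  open import Data.Nat.Divisibility using (_∣_; divides; ∣-refl; ∣m+n∣m⇒∣n)
  open import Data.Nat.DivMod using (_/_; m/n*n≡m)
  open import Data.Nat.GCD using (gcd; gcd[m,n]∣m; gcd[m,n]∣n; gcd[m,n]≢0)
  open import Data.Nat.Coprimality using (Coprime; coprime-/gcd; coprime-divisor)
  import Data.Nat.Coprimality as Coprime
  import Data.Nat.Tactic.RingSolver as ℕ-Solver
  open import Data.Sum using (inj₂)

  coprime-root⇒n≡1 : ∀ {m n x y} → Coprime m n → m * m * m + 2 * (n * n * n) * y ≡ 3 * m * (n * n) * x → n ≡ 1
  coprime-root⇒n≡1 {m} {n} {x} {y} coprime root =
    coprime (coprime-divisor (Coprime.sym coprime) (coprime-divisor (Coprime.sym coprime) n∣m³) , ∣-refl)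
    where
    n∣m³ : n ∣ m * (m * m)
    n∣m³ = ∣m+n∣m⇒∣n (divides (3 * m * n * x) (trans root′ (e₁ m n x))) (divides (2 * (n * n) * y) (e₂ n y))
      where
      root′ : 2 * (n * n * n) * y + m * (m * m) ≡ 3 * m * (n * n) * x
      root′ = trans (ℕₚ.+-comm _ (m * (m * m))) (trans (cong (_+ 2 * (n * n * n) * y) (sym (ℕₚ.*-assoc m m m))) root)
      e₁ : ∀ m n x → 3 * m * (n * n) * x ≡ 3 * m * n * x * n
      e₁ = ℕ-Solver.solve-∀
      e₂ : ∀ n y → 2 * (n * n * n) * y ≡ 2 * (n * n) * y * n
      e₂ = ℕ-Solver.solve-∀

  -- C = 0 says that p / q is a root of t³ - 3 x t + 2 y; by the rational root theorem it is an integer.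
  rational-root-integral : ∀ {p q x y} → 1 ≤ q →
    p * p * p + 2 * (q * q * q) * y ≡ 3 * p * (q * q) * x →
    ∃ λ m → p ≡ m * q × m * m * m + 2 * y ≡ 3 * m * x
  rational-root-integral {p} {q} {x} {y} 1≤q root = m , p≡mq , m-root
    where
    d = gcd p q
    instance
      d≢0 : NonZero d
      d≢0 = ≢-nonZero (gcd[m,n]≢0 p q (inj₂ λ q≡0 → ℕₚ.<⇒≢ 1≤q (sym q≡0)))
    m = p / d
    n = q / d
    p≡md : p ≡ m * d
    p≡md = sym (m/n*n≡m (gcd[m,n]∣m p q))
    q≡nd : q ≡ n * d
    q≡nd = sym (m/n*n≡m (gcd[m,n]∣n p q))
    reduced : m * m * m + 2 * (n * n * n) * y ≡ 3 * m * (n * n) * x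
    reduced = ℕₚ.*-cancelʳ-≡ _ _ (d * d * d) {{>-nonZero (ℕₚ.*-mono-< (ℕₚ.*-mono-< 0<d 0<d) 0<d)}} (begin
      (m * m * m + 2 * (n * n * n) * y) * (d * d * d)  ≡⟨ scale₁ m n y d ⟩
      (m * d) * (m * d) * (m * d) + 2 * ((n * d) * (n * d) * (n * d)) * y
        ≡⟨ cong₂ (λ a b → a * a * a + 2 * (b * b * b) * y) (sym p≡md) (sym q≡nd) ⟩
      p * p * p + 2 * (q * q * q) * y                 ≡⟨ root ⟩
      3 * p * (q * q) * x                             ≡⟨ cong₂ (λ a b → 3 * a * (b * b) * x) p≡md q≡nd ⟩
      3 * (m * d) * ((n * d) * (n * d)) * x           ≡⟨ scale₂ m n x d ⟩
      3 * m * (n * n) * x * (d * d * d)               ∎)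
      where
      open ≡-Reasoning
      0<d = >-nonZero⁻¹ d
      scale₁ : ∀ m n y d → (m * m * m + 2 * (n * n * n) * y) * (d * d * d)
                         ≡ (m * d) * (m * d) * (m * d) + 2 * ((n * d) * (n * d) * (n * d)) * y
      scale₁ = ℕ-Solver.solve-∀
      scale₂ : ∀ m n x d → 3 * (m * d) * ((n * d) * (n * d)) * x ≡ 3 * m * (n * n) * x * (d * d * d)
      scale₂ = ℕ-Solver.solve-∀
    n≡1 : n ≡ 1
    n≡1 = coprime-root⇒n≡1 (coprime-/gcd p q) reduced
    p≡mq : p ≡ m * q
    p≡mq = trans p≡md (cong (m *_) (sym (trans q≡nd (trans (cong (_* d) n≡1) (ℕₚ.*-identityˡ d)))))
    m-root : m * m * m + 2 * y ≡ 3 * m * x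
    m-root = trans (subst (λ t → m * m * m + 2 * (t * t * t) * y ≡ 3 * m * (t * t) * x) n≡1 reduced)
                   (cong (_* x) (ℕₚ.*-identityʳ (3 * m)))

module CubicSign where

  open import Relation.Binary.PropositionalEquality
  open import Data.Nat as ℕ using (ℕ; zero; suc; z≤n)
  import Data.Nat.Properties as ℕₚ
  open import Data.Integer using (ℤ; +_; -[1+_]; _+_; _-_; _*_; -_; _^_; ∣_∣; _≤_; _<_; +≤+; +<+; -≤+)
  open import Data.Integer.Properties
    using (pos-*; pos-+; i-j≡0⇒i≡j; +-injective; ∣i*j∣≡∣i∣*∣j∣; ∣i+j∣≤∣i∣+∣j∣; ∣i-j∣≤∣i∣+∣j∣; m-n≡m⊖n; ⊖-≥; <-irrefl; +-mono-≤)
  open import Data.Integer.Tactic.RingSolver using (solve-∀)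
  open import Data.Empty using (⊥-elim)
  open import Defs using (C)
  open Identities using (Cᴬ)

  pos-cube : ∀ n → + (n ℕ.* n ℕ.* n) ≡ + n * + n * + n
  pos-cube n = trans (pos-* (n ℕ.* n) n) (cong (_* + n) (pos-* n n))

  i≤+∣i∣ : ∀ i → i ≤ + ∣ i ∣
  i≤+∣i∣ (+ _)      = Data.Integer.Properties.≤-refl
  i≤+∣i∣ -[1+ _ ]   = -≤+

  quotient-nonNeg : ∀ n {u v c} → + 0 ≤ u → ∣ v ∣ ℕ.< n → u - v ≡ + n * c → + 0 ≤ c
  quotient-nonNeg n {c = + _}      _   _   _  = +≤+ z≤n
  quotient-nonNeg n {u} {v} {c = -[1+ m ]} 0≤u ∣v∣<n eq = ⊥-elim (<-irrefl refl (begin-strict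
    + n                          ≤⟨ +≤+ (ℕₚ.m≤m*n n (suc m)) ⟩
    + (n ℕ.* suc m)              ≡⟨ pos-* n (suc m) ⟩
    + n * + suc m                ≡⟨ +-identityˡ (+ n * + suc m) ⟨
    + 0 + + n * + suc m          ≤⟨ +-mono-≤ 0≤u ≤-refl ⟩
    u + + n * + suc m            ≡⟨ rearrange u v (+ n) (+ suc m) ⟩
    v + (u - v - + n * - + suc m) ≡⟨ cong (λ w → v + (w - + n * - + suc m)) eq ⟩
    v + (+ n * - + suc m - + n * - + suc m) ≡⟨ cancel v (+ n * - + suc m) ⟩
    v                            ≤⟨ i≤+∣i∣ v ⟩
    + ∣ v ∣                      <⟨ +<+ ∣v∣<n ⟩
    + n                          ∎))
    where
    open Data.Integer.Properties.≤-Reasoning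
    open Data.Integer.Properties using (≤-refl; +-identityˡ)
    rearrange : ∀ u v N M → u + N * M ≡ v + (u - v - N * (- M))
    rearrange = solve-∀
    cancel : ∀ v w → v + (w - w) ≡ v
    cancel = solve-∀

  C≡0⇒root : ∀ q p x y → C q p x y ≡ + 0 →
             p ℕ.* p ℕ.* p ℕ.+ 2 ℕ.* (q ℕ.* q ℕ.* q) ℕ.* y ≡ 3 ℕ.* p ℕ.* (q ℕ.* q) ℕ.* x
  C≡0⇒root q p x y C≡0 = +-injective (i-j≡0⇒i≡j _ _ (begin
    + (p ℕ.* p ℕ.* p ℕ.+ 2 ℕ.* (q ℕ.* q ℕ.* q) ℕ.* y) - + (3 ℕ.* p ℕ.* (q ℕ.* q) ℕ.* x)
      ≡⟨ cong₂ _-_ (trans (pos-+ (p ℕ.* p ℕ.* p) (2 ℕ.* (q ℕ.* q ℕ.* q) ℕ.* y)) (cong₂ _+_ (pos-cube p) cast₁)) cast₂ ⟩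
    + p * + p * + p + + 2 * (+ q * + q * + q) * + y - + 3 * + p * (+ q * + q) * + x
      ≡⟨ expand (+ p) (+ q) (+ x) (+ y) ⟨
    C q p x y
      ≡⟨ C≡0 ⟩
    + 0 ∎))
    where
    open ≡-Reasoning
    cast₁ : + (2 ℕ.* (q ℕ.* q ℕ.* q) ℕ.* y) ≡ + 2 * (+ q * + q * + q) * + y
    cast₁ = trans (pos-* (2 ℕ.* (q ℕ.* q ℕ.* q)) y) (cong (_* + y) (trans (pos-* 2 (q ℕ.* q ℕ.* q)) (cong (+ 2 *_) (pos-cube q))))
    cast₂ : + (3 ℕ.* p ℕ.* (q ℕ.* q) ℕ.* x) ≡ + 3 * + p * (+ q * + q) * + x
    cast₂ = trans (pos-* (3 ℕ.* p ℕ.* (q ℕ.* q)) x) (cong (_* + x) (trans (pos-* (3 ℕ.* p) (q ℕ.* q)) (cong₂ _*_ (pos-* 3 p) (pos-* q q))))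
    expand : ∀ P Q X Y → P * (P * (P * + 1)) - + 3 * P * (Q * (Q * + 1)) * X + + 2 * (Q * (Q * (Q * + 1))) * Y
                       ≡ P * P * P + + 2 * (Q * Q * Q) * Y - + 3 * P * (Q * Q) * X
    expand = solve-∀

  root⇒4k≡ : ∀ {m x y} → m ℕ.* m ℕ.* m ℕ.+ 2 ℕ.* y ≡ 3 ℕ.* m ℕ.* x →
    + 4 * ((+ x) ^ 3 - (+ y) ^ 2) ≡ (+ m * + m - + x) * (+ m * + m - + x) * (+ 4 * + x - + m * + m)
  root⇒4k≡ {m} {x} {y} root = begin
    + 4 * ((+ x) ^ 3 - (+ y) ^ 2)
      ≡⟨ factor (+ m) (+ x) (+ y) ⟩
    D * D * S - (+ m * + m * + m + + 2 * + y - + 3 * + m * + x) * (+ 3 * + m * + x - + m * + m * + m + + 2 * + y)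
      ≡⟨ cong (λ e → D * D * S - (e - + 3 * + m * + x) * (+ 3 * + m * + x - + m * + m * + m + + 2 * + y)) rootℤ ⟩
    D * D * S - (+ 3 * + m * + x - + 3 * + m * + x) * (+ 3 * + m * + x - + m * + m * + m + + 2 * + y)
      ≡⟨ cancel (D * D * S) (+ 3 * + m * + x) _ ⟩
    D * D * S ∎
    where
    open ≡-Reasoning
    D = + m * + m - + x
    S = + 4 * + x - + m * + m
    rootℤ : + m * + m * + m + + 2 * + y ≡ + 3 * + m * + x
    rootℤ = begin
      + m * + m * + m + + 2 * + y ≡⟨ cong₂ _+_ (pos-cube m) (pos-* 2 y) ⟨
      + (m ℕ.* m ℕ.* m) + + (2 ℕ.* y) ≡⟨ pos-+ (m ℕ.* m ℕ.* m) (2 ℕ.* y) ⟨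
      + (m ℕ.* m ℕ.* m ℕ.+ 2 ℕ.* y) ≡⟨ cong +_ root ⟩
      + (3 ℕ.* m ℕ.* x)           ≡⟨ trans (pos-* (3 ℕ.* m) x) (cong (_* + x) (pos-* 3 m)) ⟩
      + 3 * + m * + x             ∎
    factor : ∀ M X Y → + 4 * (X * (X * (X * + 1)) - Y * (Y * + 1))
           ≡ (M * M - X) * (M * M - X) * (+ 4 * X - M * M)
             - (M * M * M + + 2 * Y - + 3 * M * X) * (+ 3 * M * X - M * M * M + + 2 * Y)
    factor = solve-∀
    cancel : ∀ a t b → a - (t - t) * b ≡ a
    cancel = solve-∀

  integral-root⇒k≡0 : ∀ {m x y} → m ℕ.* m ℕ.* m ℕ.+ 2 ℕ.* y ≡ 3 ℕ.* m ℕ.* x →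
    m ℕ.* m ℕ.+ 4 ℕ.* ∣ (+ x) ^ 3 - (+ y) ^ 2 ∣ ℕ.< 4 ℕ.* x → ∣ (+ x) ^ 3 - (+ y) ^ 2 ∣ ≡ 0
  integral-root⇒k≡0 {m} {x} {y} root small = cases ∣ D ∣ refl
    where
    κ = ∣ (+ x) ^ 3 - (+ y) ^ 2 ∣
    s = 4 ℕ.* x ℕ.∸ m ℕ.* m
    m²≤4x : m ℕ.* m ℕ.≤ 4 ℕ.* x
    m²≤4x = ℕₚ.≤-trans (ℕₚ.m≤m+n _ _) (ℕₚ.<⇒≤ small)
    S≡s : + 4 * + x - + m * + m ≡ + s
    S≡s = trans (cong₂ _-_ (sym (pos-* 4 x)) (sym (pos-* m m))) (trans (m-n≡m⊖n (4 ℕ.* x) (m ℕ.* m)) (⊖-≥ m²≤4x))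
    D = + m * + m - + x
    4κ≡d²s : 4 ℕ.* κ ≡ ∣ D ∣ ℕ.* ∣ D ∣ ℕ.* s
    4κ≡d²s = begin
      4 ℕ.* κ                ≡⟨ ∣i*j∣≡∣i∣*∣j∣ (+ 4) ((+ x) ^ 3 - (+ y) ^ 2) ⟨
      ∣ + 4 * ((+ x) ^ 3 - (+ y) ^ 2) ∣ ≡⟨ cong ∣_∣ (root⇒4k≡ {m} {x} {y} root) ⟩
      ∣ D * D * (+ 4 * + x - + m * + m) ∣ ≡⟨ cong (λ t → ∣ D * D * t ∣) S≡s ⟩
      ∣ D * D * + s ∣        ≡⟨ ∣i*j∣≡∣i∣*∣j∣ (D * D) (+ s) ⟩
      ∣ D * D ∣ ℕ.* s        ≡⟨ cong (ℕ._* s) (∣i*j∣≡∣i∣*∣j∣ D D) ⟩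
      ∣ D ∣ ℕ.* ∣ D ∣ ℕ.* s  ∎
      where open ≡-Reasoning
    4κ<s : 4 ℕ.* κ ℕ.< s
    4κ<s = ℕₚ.+-cancelˡ-< (m ℕ.* m) (4 ℕ.* κ) s
             (subst (m ℕ.* m ℕ.+ 4 ℕ.* κ ℕ.<_) (sym (ℕₚ.m+[n∸m]≡n m²≤4x)) small)
    cases : ∀ d → ∣ D ∣ ≡ d → κ ≡ 0
    cases zero    d≡0 = ℕₚ.*-cancelˡ-≡ κ 0 4 (trans 4κ≡d²s (cong (λ d → d ℕ.* d ℕ.* s) d≡0))
    cases (suc d) d≡  = ⊥-elim (ℕₚ.<-irrefl refl (ℕₚ.<-≤-trans 4κ<s (ℕₚ.≤-trans (ℕₚ.m≤n*m s (suc d ℕ.* suc d))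
                          (ℕₚ.≤-reflexive (sym (trans 4κ≡d²s (cong (λ d → d ℕ.* d ℕ.* s) d≡)))))))

  module _ (A K : ℤ) (q y : ℕ) where

    private
      U V : ℤ
      U = A * A * (A + + 3 * + q * + y)
      V = + q * + q * K * (+ 3 * A + + q * + y)

      ∣+m*+n∣ : ∀ m n → ∣ + m * + n ∣ ≡ m ℕ.* n
      ∣+m*+n∣ m n = ∣i*j∣≡∣i∣*∣j∣ (+ m) (+ n)

      ∣U∣≤ : ∣ U ∣ ℕ.≤ ∣ A ∣ ℕ.* ∣ A ∣ ℕ.* (∣ A ∣ ℕ.+ 3 ℕ.* q ℕ.* y)
      ∣U∣≤ = begin
        ∣ A * A * (A + + 3 * + q * + y) ∣            ≡⟨ ∣i*j∣≡∣i∣*∣j∣ (A * A) (A + + 3 * + q * + y) ⟩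
        ∣ A * A ∣ ℕ.* ∣ A + + 3 * + q * + y ∣        ≡⟨ cong (ℕ._* ∣ A + + 3 * + q * + y ∣) (∣i*j∣≡∣i∣*∣j∣ A A) ⟩
        ∣ A ∣ ℕ.* ∣ A ∣ ℕ.* ∣ A + + 3 * + q * + y ∣  ≤⟨ ℕₚ.*-monoʳ-≤ (∣ A ∣ ℕ.* ∣ A ∣) ∣A+3qy∣≤ ⟩
        ∣ A ∣ ℕ.* ∣ A ∣ ℕ.* (∣ A ∣ ℕ.+ 3 ℕ.* q ℕ.* y) ∎
        where
        open ℕₚ.≤-Reasoning
        ∣A+3qy∣≤ : ∣ A + + 3 * + q * + y ∣ ℕ.≤ ∣ A ∣ ℕ.+ 3 ℕ.* q ℕ.* y
        ∣A+3qy∣≤ = ℕₚ.≤-trans (∣i+j∣≤∣i∣+∣j∣ A (+ 3 * + q * + y))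
          (ℕₚ.≤-reflexive (cong (∣ A ∣ ℕ.+_) (trans (∣i*j∣≡∣i∣*∣j∣ (+ 3 * + q) (+ y)) (cong (ℕ._* y) (∣+m*+n∣ 3 q)))))

      ∣V∣≤ : ∣ V ∣ ℕ.≤ q ℕ.* q ℕ.* ∣ K ∣ ℕ.* (3 ℕ.* ∣ A ∣ ℕ.+ q ℕ.* y)
      ∣V∣≤ = begin
        ∣ + q * + q * K * (+ 3 * A + + q * + y) ∣       ≡⟨ ∣i*j∣≡∣i∣*∣j∣ (+ q * + q * K) (+ 3 * A + + q * + y) ⟩
        ∣ + q * + q * K ∣ ℕ.* ∣ + 3 * A + + q * + y ∣   ≡⟨ cong (ℕ._* ∣ + 3 * A + + q * + y ∣)
                                                           (trans (∣i*j∣≡∣i∣*∣j∣ (+ q * + q) K) (cong (ℕ._* ∣ K ∣) (∣+m*+n∣ q q))) ⟩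
        q ℕ.* q ℕ.* ∣ K ∣ ℕ.* ∣ + 3 * A + + q * + y ∣   ≤⟨ ℕₚ.*-monoʳ-≤ (q ℕ.* q ℕ.* ∣ K ∣) ∣3A+qy∣≤ ⟩
        q ℕ.* q ℕ.* ∣ K ∣ ℕ.* (3 ℕ.* ∣ A ∣ ℕ.+ q ℕ.* y) ∎
        where
        open ℕₚ.≤-Reasoning
        ∣3A+qy∣≤ : ∣ + 3 * A + + q * + y ∣ ℕ.≤ 3 ℕ.* ∣ A ∣ ℕ.+ q ℕ.* y
        ∣3A+qy∣≤ = ℕₚ.≤-trans (∣i+j∣≤∣i∣+∣j∣ (+ 3 * A) (+ q * + y))
          (ℕₚ.≤-reflexive (cong₂ ℕ._+_ (∣i*j∣≡∣i∣*∣j∣ (+ 3) A) (∣+m*+n∣ q y)))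

      0≤U : ∣ A ∣ ℕ.≤ 3 ℕ.* q ℕ.* y → + 0 ≤ U
      0≤U ∣A∣≤3qy = 0≤i*j (0≤i*i A) (subst (λ t → + 0 ≤ A + t) (sym 3qy≡) (0≤i+t A ∣A∣≤3qy))
        where
        3qy≡ : + 3 * + q * + y ≡ + (3 ℕ.* q ℕ.* y)
        3qy≡ = sym (trans (pos-* (3 ℕ.* q) y) (cong (_* + y) (pos-* 3 q)))
        0≤i*j : ∀ {i j} → + 0 ≤ i → + 0 ≤ j → + 0 ≤ i * j
        0≤i*j {+ a} {+ b} _ _ = subst (+ 0 ≤_) (pos-* a b) (+≤+ z≤n)
        0≤i*i : ∀ i → + 0 ≤ i * i
        0≤i*i (+ a)    = 0≤i*j {+ a} {+ a} (+≤+ z≤n) (+≤+ z≤n)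
        0≤i*i -[1+ a ] = +≤+ z≤n
        0≤i+t : ∀ i {t} → ∣ i ∣ ℕ.≤ t → + 0 ≤ i + + t
        0≤i+t (+ a)          _   = +≤+ z≤n
        0≤i+t -[1+ a ] {t} a<t = subst (+ 0 ≤_) (sym (⊖-≥ a<t)) (+≤+ z≤n)

    ∣Cᴬ∣≤ : ∣ Cᴬ A (+ q) (+ y) K ∣ ℕ.≤ ∣ A ∣ ℕ.* ∣ A ∣ ℕ.* (∣ A ∣ ℕ.+ 3 ℕ.* q ℕ.* y) ℕ.+ q ℕ.* q ℕ.* ∣ K ∣ ℕ.* (3 ℕ.* ∣ A ∣ ℕ.+ q ℕ.* y)
    ∣Cᴬ∣≤ = ℕₚ.≤-trans (∣i-j∣≤∣i∣+∣j∣ U V) (ℕₚ.+-mono-≤ ∣U∣≤ ∣V∣≤)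

    -- Cᴬ = U - V with U ≥ 0, so a multiple n c of Cᴬ with n > |V| has c ≥ 0.
    Cᴬ≡n*c⇒0≤c : ∀ n {c} → ∣ A ∣ ℕ.≤ 3 ℕ.* q ℕ.* y → q ℕ.* q ℕ.* ∣ K ∣ ℕ.* (3 ℕ.* ∣ A ∣ ℕ.+ q ℕ.* y) ℕ.< n →
                 Cᴬ A (+ q) (+ y) K ≡ + n * c → + 0 ≤ c
    Cᴬ≡n*c⇒0≤c n {c} ∣A∣≤3qy small eq = quotient-nonNeg n {U} {V} {c} (0≤U ∣A∣≤3qy) (ℕₚ.≤-<-trans ∣V∣≤ small) eq

module SizeEstimates where

  open import Data.Nat
  open import Data.Nat.Properties
  open import Data.Nat.Tactic.RingSolver using (solve-∀)
  open import Data.Vec using ([]; _∷_)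
  open import Data.Empty using (⊥-elim)
  open import Relation.Binary.PropositionalEquality
  open import Relation.Nullary using (Dec; yes; no)
  open import Relation.Nullary.Decidable using (True; toWitness)
  open SignedSums using (evalAbs)
  open Identities using (F-terms; H-terms)

  literal : ∀ {m n} {_ : True (m ≤? n)} → m ≤ n
  literal {_} {_} {m≤n} = toWitness m≤n

  square-mono-≤ : ∀ {m n} → m ≤ n → m * m ≤ n * n
  square-mono-≤ m≤n = *-mono-≤ m≤n m≤n

  square-mono-< : ∀ {m n} → m < n → m * m < n * n
  square-mono-< m<n = *-mono-< m<n m<n

  square-cancel-< : ∀ {m n} → m * m < n * n → m < n
  square-cancel-< {m} {n} m²<n² = ≰⇒> λ n≤m → <-irrefl refl (<-≤-trans m²<n² (square-mono-≤ n≤m))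

  square-cancel-≤ : ∀ {m n} → m * m ≤ n * n → m ≤ n
  square-cancel-≤ {m} {n} m²≤n² = ≮⇒≥ λ n<m → <-irrefl refl (≤-<-trans m²≤n² (square-mono-< n<m))

  cube-mono-≤ : ∀ {m n} → m ≤ n → m * m * m ≤ n * n * n
  cube-mono-≤ m≤n = *-mono-≤ (*-mono-≤ m≤n m≤n) m≤n

  pow4-mono-≤ : ∀ {m n} → m ≤ n → m * m * m * m ≤ n * n * n * n
  pow4-mono-≤ m≤n = *-mono-≤ (cube-mono-≤ m≤n) m≤n

  pow5-mono-≤ : ∀ {m n} → m ≤ n → m * m * m * m * m ≤ n * n * n * n * n
  pow5-mono-≤ m≤n = *-mono-≤ (pow4-mono-≤ m≤n) m≤n

  pow6-mono-≤ : ∀ {m n} → m ≤ n → m * m * m * m * m * m ≤ n * n * n * n * n * n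
  pow6-mono-≤ m≤n = *-mono-≤ (pow5-mono-≤ m≤n) m≤n

  c*k≤n⇒k<n : ∀ {c k n} → 2 ≤ c → 0 < n → c * k ≤ n → k < n
  c*k≤n⇒k<n {k = zero}  _   0<n _    = 0<n
  c*k≤n⇒k<n {c} {suc k} {n} 2≤c _ ck≤n = <-≤-trans (m<m*n (suc k) c 2≤c) (subst (_≤ n) (*-comm c (suc k)) ck≤n)

  -- The ring solver does not know _^_, so these are solved on the unfolding of n ^ k.
  ^2≡ : ∀ n → n ^ 2 ≡ n * n
  ^2≡ = identity
    where identity : ∀ n → n * (n * 1) ≡ n * n
          identity = solve-∀

  ^3≡ : ∀ n → n ^ 3 ≡ n * n * n
  ^3≡ = identity
    where identity : ∀ n → n * (n * (n * 1)) ≡ n * n * n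
          identity = solve-∀

  ^4≡ : ∀ n → n ^ 4 ≡ n * n * n * n
  ^4≡ = identity
    where identity : ∀ n → n * (n * (n * (n * 1))) ≡ n * n * n * n
          identity = solve-∀

  ^6≡ : ∀ n → n ^ 6 ≡ n * n * n * n * n * n
  ^6≡ = identity
    where identity : ∀ n → n * (n * (n * (n * (n * (n * 1))))) ≡ n * n * n * n * n * n
          identity = solve-∀

  -- α stands for |p x - q y| and κ for |x³ - y²|.
  module Estimates (x y q R α κ : ℕ)
    (4096≤x : 4096 ≤ x) (1≤q : 1 ≤ q) (q<R : q < R) (x≤R^6 : x ≤ R ^ 6) (q^6<x : q ^ 6 < x)
    (Rα≤x : R * α ≤ x) (κ^2<x : κ ^ 2 < x) (y^2≤x^3+κ : y ^ 2 ≤ x ^ 3 + κ) (x^3≤y^2+κ : x ^ 3 ≤ y ^ 2 + κ)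
    where

    open ≤-Reasoning

    private
      x≤R⁶ : x ≤ R * R * R * R * R * R
      x≤R⁶ = subst (x ≤_) (^6≡ R) x≤R^6
      q⁶<x : q * q * q * q * q * q < x
      q⁶<x = subst (_< x) (^6≡ q) q^6<x
      κ²<x : κ * κ < x
      κ²<x = subst (_< x) (^2≡ κ) κ^2<x
      y²≤x³+κ : y * y ≤ x * x * x + κ
      y²≤x³+κ = subst₂ (λ a b → a ≤ b + κ) (^2≡ y) (^3≡ x) y^2≤x^3+κ
      x³≤y²+κ : x * x * x ≤ y * y + κ
      x³≤y²+κ = subst₂ (λ a b → a ≤ b + κ) (^3≡ x) (^2≡ y) x^3≤y^2+κ

      x³ = x * x * x
      x⁴ = x * x * x * x
      x⁵ = x * x * x * x * x
      x⁶ = x * x * x * x * x * x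
      x⁸ = x * x * x * x * x * x * x * x
      q⁴ = q * q * q * q

      ≤x : ∀ n {_ : True (n ≤? 4096)} → n ≤ x
      ≤x n {n≤4096} = ≤-trans (toWitness n≤4096) 4096≤x

      0<x : 0 < x
      0<x = ≤x 1

      0<x² : 0 < x * x
      0<x² = *-mono-< 0<x 0<x

      0<x³ : 0 < x³
      0<x³ = *-mono-< 0<x² 0<x

      0<x⁴ : 0 < x⁴
      0<x⁴ = *-mono-< 0<x³ 0<x

      0<x⁶ : 0 < x⁶
      0<x⁶ = *-mono-< (*-mono-< 0<x⁴ 0<x) 0<x

      x≤x³ : x ≤ x³
      x≤x³ = ≤-trans (m≤m*n x (x * x) {{>-nonZero 0<x²}}) (≤-reflexive (sym (*-assoc x x x)))

      x⁴≤x⁵ : x⁴ ≤ x⁵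
      x⁴≤x⁵ = m≤m*n x⁴ x {{>-nonZero 0<x}}

    4≤R : 4 ≤ R
    4≤R = ≰⇒> λ R≤3 → <⇒≱ (literal {730} {4096}) (≤-trans 4096≤x (≤-trans x≤R⁶ (pow6-mono-≤ R≤3)))

    private
      0<R : 0 < R
      0<R = ≤-trans (s≤s z≤n) 4≤R

      0<R³ : 0 < R * R * R
      0<R³ = *-mono-< (*-mono-< 0<R 0<R) 0<R

    4α≤x : 4 * α ≤ x
    4α≤x = ≤-trans (*-monoˡ-≤ α 4≤R) Rα≤x

    α<x : α < x
    α<x = c*k≤n⇒k<n (literal {2} {4}) 0<x 4α≤x

    α≤x : α ≤ x
    α≤x = <⇒≤ α<x

    64κ≤x : 64 * κ ≤ x
    64κ≤x = ≮⇒≥ λ x<64κ → <-irrefl refl (begin-strict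
      x * x               <⟨ square-mono-< x<64κ ⟩
      64 * κ * (64 * κ)   ≡⟨ e κ ⟩
      4096 * (κ * κ)      ≤⟨ *-monoʳ-≤ 4096 (<⇒≤ κ²<x) ⟩
      4096 * x            ≤⟨ *-monoˡ-≤ x 4096≤x ⟩
      x * x               ∎)
      where e : ∀ k → 64 * k * (64 * k) ≡ 4096 * (k * k)
            e = solve-∀

    κ≤x : κ ≤ x
    κ≤x = ≤-trans (m≤n*m κ 64) 64κ≤x

    κ<x : κ < x
    κ<x = c*k≤n⇒k<n (literal {2} {64}) 0<x 64κ≤x

    q³κ<x : q * q * q * κ < x
    q³κ<x = square-cancel-< (begin-strict
      q * q * q * κ * (q * q * q * κ)      ≡⟨ e q κ ⟩
      q * q * q * q * q * q * (κ * κ)      <⟨ *-mono-< q⁶<x κ²<x ⟩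
      x * x                                ∎)
      where e : ∀ q k → q * q * q * k * (q * q * q * k) ≡ q * q * q * q * q * q * (k * k)
            e = solve-∀

    q²κ<x : q * q * κ < x
    q²κ<x = ≤-<-trans (≤-trans (m≤n*m (q * q * κ) q {{>-nonZero 1≤q}}) (≤-reflexive (e q κ))) q³κ<x
      where e : ∀ q k → q * (q * q * k) ≡ q * q * q * k
            e = solve-∀

    qκ<x : q * κ < x
    qκ<x = ≤-<-trans (≤-trans (m≤n*m (q * κ) q {{>-nonZero 1≤q}}) (≤-reflexive (sym (*-assoc q q κ)))) q²κ<x

    x≤y : x ≤ y
    x≤y = ≮⇒≥ λ y<x → <-irrefl refl (begin-strict
      x³            ≤⟨ x³≤y²+κ ⟩
      y * y + κ     <⟨ +-mono-< (square-mono-< y<x) κ<x ⟩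
      x * x + x     ≤⟨ +-monoʳ-≤ (x * x) (m≤m*n x x {{>-nonZero 0<x}}) ⟩
      x * x + x * x ≡⟨ e x ⟩
      2 * (x * x)   ≤⟨ *-monoˡ-≤ (x * x) (≤x 2) ⟩
      x * (x * x)   ≡⟨ *-assoc x x x ⟨
      x³            ∎)
      where e : ∀ x → x * x + x * x ≡ 2 * (x * x)
            e = solve-∀

    α≤3qy : α ≤ 3 * q * y
    α≤3qy = begin
      α         ≤⟨ α≤x ⟩
      x         ≤⟨ x≤y ⟩
      y         ≤⟨ m≤n*m y (3 * q) {{>-nonZero (≤-trans 1≤q (m≤n*m q 3))}} ⟩
      3 * q * y ∎

    32y≤x² : 32 * y ≤ x * x
    32y≤x² = square-cancel-≤ (begin
      32 * y * (32 * y)        ≡⟨ e₁ y ⟩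
      1024 * (y * y)           ≤⟨ *-monoʳ-≤ 1024 y²≤x³+κ ⟩
      1024 * (x³ + κ)          ≤⟨ *-monoʳ-≤ 1024 (+-monoʳ-≤ x³ (≤-trans κ≤x x≤x³)) ⟩
      1024 * (x³ + x³)         ≡⟨ e₂ x ⟩
      2048 * x³                ≤⟨ *-monoˡ-≤ x³ (≤x 2048) ⟩
      x * x³                   ≡⟨ e₃ x ⟩
      x * x * (x * x)          ∎)
      where e₁ : ∀ y → 32 * y * (32 * y) ≡ 1024 * (y * y)
            e₁ = solve-∀
            e₂ : ∀ x → 1024 * (x * x * x + x * x * x) ≡ 2048 * (x * x * x)
            e₂ = solve-∀
            e₃ : ∀ x → x * (x * x * x) ≡ x * x * (x * x)
            e₃ = solve-∀

    y≤xR³ : y ≤ x * (R * R * R)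
    y≤xR³ = ≮⇒≥ λ xR³<y → <-irrefl refl (begin-strict
      x³ + κ                                          <⟨ +-monoʳ-< x³ (s≤s (≤-trans κ≤x (≤-trans x≤xR³ (m≤m+n _ _)))) ⟩
      x³ + suc (x * (R * R * R) + x * (R * R * R))    ≤⟨ +-monoˡ-≤ _ (*-monoʳ-≤ (x * x) x≤R⁶) ⟩
      x * x * (R * R * R * R * R * R) + suc (x * (R * R * R) + x * (R * R * R)) ≡⟨ e x R ⟩
      suc (x * (R * R * R)) * suc (x * (R * R * R))   ≤⟨ square-mono-≤ xR³<y ⟩
      y * y                                           ≤⟨ y²≤x³+κ ⟩
      x³ + κ                                          ∎)
      where
      x≤xR³ : x ≤ x * (R * R * R)
      x≤xR³ = m≤m*n x (R * R * R) {{>-nonZero 0<R³}}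
      e : ∀ x R → x * x * (R * R * R * R * R * R) + suc (x * (R * R * R) + x * (R * R * R))
                ≡ suc (x * (R * R * R)) * suc (x * (R * R * R))
      e = solve-∀

    p-positive : ∀ p → q * y ≤ p * x + α → 1 ≤ p
    p-positive zero    qy≤α = ⊥-elim (<-irrefl refl (begin-strict
      α      <⟨ α<x ⟩
      x      ≤⟨ x≤y ⟩
      y      ≤⟨ m≤n*m y q {{>-nonZero 1≤q}} ⟩
      q * y  ≤⟨ qy≤α ⟩
      α      ∎))
    p-positive (suc _) _ = s≤s z≤n

    -- p x ≤ q y + α forces (p - 1)² ≤ q² x, hence (p - 1)⁶ ≤ q⁶ x³ < x⁴.
    [p-1]³<x² : ∀ p → p * x ≤ q * y + α → (p ∸ 1) ^ 3 < x ^ 2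
    [p-1]³<x² zero    _ = subst (0 <_) (sym (^2≡ x)) 0<x²
    [p-1]³<x² (suc m) h = subst₂ _<_ (sym (^3≡ m)) (sym (^2≡ x)) (square-cancel-< (begin-strict
      m * m * m * (m * m * m)                ≡⟨ e₁ m ⟩
      (m * m) * (m * m) * (m * m)            ≤⟨ cube-mono-≤ m²≤q²x ⟩
      q * q * x * (q * q * x) * (q * q * x)  ≡⟨ e₂ q x ⟩
      q * q * q * q * q * q * x³             <⟨ *-monoˡ-< x³ {{>-nonZero 0<x³}} q⁶<x ⟩
      x * x³                                 ≡⟨ e₃ x ⟩
      x * x * (x * x)                        ∎))
      where
      e₁ : ∀ m → m * m * m * (m * m * m) ≡ (m * m) * (m * m) * (m * m)
      e₁ = solve-∀
      e₂ : ∀ q x → q * q * x * (q * q * x) * (q * q * x) ≡ q * q * q * q * q * q * (x * x * x)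
      e₂ = solve-∀
      e₃ : ∀ x → x * (x * x * x) ≡ x * x * (x * x)
      e₃ = solve-∀
      mx<qy : m * x < q * y
      mx<qy = +-cancelʳ-< x (m * x) (q * y) (begin-strict
        m * x + x  ≡⟨ +-comm (m * x) x ⟩
        suc m * x  ≤⟨ h ⟩
        q * y + α  <⟨ +-monoʳ-< (q * y) α<x ⟩
        q * y + x  ∎)
      m²x²<[q²x+1]x² : m * m * (x * x) < (q * q * x + 1) * (x * x)
      m²x²<[q²x+1]x² = begin-strict
        m * m * (x * x)                ≡⟨ e₄ m x ⟩
        m * x * (m * x)                <⟨ square-mono-< mx<qy ⟩
        q * y * (q * y)                ≡⟨ e₄ q y ⟨
        q * q * (y * y)                ≤⟨ *-monoʳ-≤ (q * q) y²≤x³+κ ⟩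
        q * q * (x³ + κ)               ≡⟨ e₅ q x κ ⟩
        q * q * x * (x * x) + q * q * κ ≤⟨ +-monoʳ-≤ (q * q * x * (x * x)) (<⇒≤ (<-≤-trans q²κ<x (m≤m*n x x {{>-nonZero 0<x}}))) ⟩
        q * q * x * (x * x) + x * x    ≡⟨ e₆ q x ⟩
        (q * q * x + 1) * (x * x)      ∎
        where
        e₄ : ∀ m x → m * m * (x * x) ≡ m * x * (m * x)
        e₄ = solve-∀
        e₅ : ∀ q x k → q * q * (x * x * x + k) ≡ q * q * x * (x * x) + q * q * k
        e₅ = solve-∀
        e₆ : ∀ q x → q * q * x * (x * x) + x * x ≡ (q * q * x + 1) * (x * x)
        e₆ = solve-∀
      m²≤q²x : m * m ≤ q * q * x
      m²≤q²x = s≤s⁻¹ (subst (m * m <_) (+-comm (q * q * x) 1) (*-cancelʳ-< (x * x) (m * m) (q * q * x + 1) m²x²<[q²x+1]x²))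

    m²+4κ<4x : ∀ m → m * x ≤ y + α → m * m + 4 * κ < 4 * x
    m²+4κ<4x m mx≤y+α = *-cancelʳ-< (x * x) (m * m + 4 * κ) (4 * x) (begin-strict
      (m * m + 4 * κ) * (x * x)                               ≡⟨ e₁ m κ x ⟩
      m * x * (m * x) + 4 * (κ * (x * x))                     ≤⟨ +-monoˡ-≤ _ (square-mono-≤ mx≤y+α) ⟩
      (y + α) * (y + α) + 4 * (κ * (x * x))                   ≡⟨ e₂ y α κ x ⟩
      y * y + (2 * (y * α) + α * α + 4 * (κ * (x * x)))       ≤⟨ +-monoˡ-≤ _ y²≤x³+κ ⟩
      x³ + κ + (2 * (y * α) + α * α + 4 * (κ * (x * x)))      ≡⟨ +-assoc x³ κ _ ⟩
      x³ + (κ + (2 * (y * α) + α * α + 4 * (κ * (x * x))))    ≤⟨ +-monoʳ-≤ x³ rest≤x³ ⟩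
      x³ + x³                                                 <⟨ x³+x³<4x³ ⟩
      4 * x * (x * x)                                         ∎)
      where
      e₁ : ∀ m k x → (m * m + 4 * k) * (x * x) ≡ m * x * (m * x) + 4 * (k * (x * x))
      e₁ = solve-∀
      e₂ : ∀ y a k x → (y + a) * (y + a) + 4 * (k * (x * x)) ≡ y * y + (2 * (y * a) + a * a + 4 * (k * (x * x)))
      e₂ = solve-∀
      rest≤x³ : κ + (2 * (y * α) + α * α + 4 * (κ * (x * x))) ≤ x³
      rest≤x³ = *-cancelˡ-≤ 8 (begin
        8 * (κ + (2 * (y * α) + α * α + 4 * (κ * (x * x))))       ≡⟨ e₃ κ y α x ⟩
        8 * κ + 16 * (y * α) + 8 * (α * α) + 32 * (κ * (x * x))   ≤⟨ +-mono-≤ (+-mono-≤ (+-mono-≤ t₁ t₂) t₃) t₄ ⟩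
        x³ + x³ + x³ + x³                                         ≤⟨ m≤m+n _ (4 * x³) ⟩
        x³ + x³ + x³ + x³ + 4 * x³                                ≡⟨ e₄ x³ ⟩
        8 * x³                                                    ∎)
        where
        e₃ : ∀ k y a x → 8 * (k + (2 * (y * a) + a * a + 4 * (k * (x * x))))
                       ≡ 8 * k + 16 * (y * a) + 8 * (a * a) + 32 * (k * (x * x))
        e₃ = solve-∀
        e₄ : ∀ X → X + X + X + X + 4 * X ≡ 8 * X
        e₄ = solve-∀
        t₁ : 8 * κ ≤ x³
        t₁ = ≤-trans (*-monoˡ-≤ κ (literal {8} {64})) (≤-trans 64κ≤x x≤x³)
        t₂ : 16 * (y * α) ≤ x³
        t₂ = *-cancelˡ-≤ 8 (begin
          8 * (16 * (y * α))   ≡⟨ e y α ⟩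
          (32 * y) * (4 * α)   ≤⟨ *-mono-≤ 32y≤x² 4α≤x ⟩
          x³                   ≤⟨ m≤n*m x³ 8 ⟩
          8 * x³               ∎)
          where e : ∀ y a → 8 * (16 * (y * a)) ≡ (32 * y) * (4 * a)
                e = solve-∀
        t₃ : 8 * (α * α) ≤ x³
        t₃ = *-cancelˡ-≤ 2 (begin
          2 * (8 * (α * α))    ≡⟨ e α ⟩
          (4 * α) * (4 * α)    ≤⟨ square-mono-≤ 4α≤x ⟩
          x * x                ≤⟨ m≤m*n (x * x) x {{>-nonZero 0<x}} ⟩
          x³                   ≤⟨ m≤n*m x³ 2 ⟩
          2 * x³               ∎)
          where e : ∀ a → 2 * (8 * (a * a)) ≡ (4 * a) * (4 * a)
                e = solve-∀
        t₄ : 32 * (κ * (x * x)) ≤ x³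
        t₄ = *-cancelˡ-≤ 2 (begin
          2 * (32 * (κ * (x * x)))  ≡⟨ e κ x ⟩
          (64 * κ) * (x * x)        ≤⟨ *-monoˡ-≤ (x * x) 64κ≤x ⟩
          x * (x * x)               ≡⟨ *-assoc x x x ⟨
          x³                        ≤⟨ m≤n*m x³ 2 ⟩
          2 * x³                    ∎)
          where e : ∀ k x → 2 * (32 * (k * (x * x))) ≡ (64 * k) * (x * x)
                e = solve-∀
      x³+x³<4x³ : x³ + x³ < 4 * x * (x * x)
      x³+x³<4x³ = begin-strict
        x³ + x³                 <⟨ +-monoʳ-< x³ (m<m+n x³ 0<x³) ⟩
        x³ + (x³ + x³)          ≤⟨ m≤m+n _ x³ ⟩
        x³ + (x³ + x³) + x³     ≡⟨ e x ⟩
        4 * x * (x * x)         ∎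
        where e : ∀ x → x * x * x + (x * x * x + x * x * x) + x * x * x ≡ 4 * x * (x * x)
              e = solve-∀

    q²κ[3α+qy]<x³ : q * q * κ * (3 * α + q * y) < x³
    q²κ[3α+qy]<x³ = begin-strict
      q * q * κ * (3 * α + q * y)                 ≡⟨ e q κ α y ⟩
      3 * α * (q * q * κ) + q * q * q * κ * y     <⟨ +-mono-≤-< (*-monoʳ-≤ (3 * α) (<⇒≤ q²κ<x))
                                                                  (*-monoˡ-< y {{>-nonZero (<-≤-trans 0<x x≤y)}} q³κ<x) ⟩
      3 * α * x + x * y                           ≤⟨ 3αx+xy≤x³ ⟩
      x³                                          ∎
      where
      e : ∀ q k a y → q * q * k * (3 * a + q * y) ≡ 3 * a * (q * q * k) + q * q * q * k * y
      e = solve-∀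
      3αx+xy≤x³ : 3 * α * x + x * y ≤ x³
      3αx+xy≤x³ = *-cancelˡ-≤ 32 (begin
        32 * (3 * α * x + x * y)                ≡⟨ e₁ α x y ⟩
        24 * x * (4 * α) + x * (32 * y)         ≤⟨ +-mono-≤ (*-monoʳ-≤ (24 * x) 4α≤x) (*-monoʳ-≤ x 32y≤x²) ⟩
        24 * x * x + x * (x * x)                ≡⟨ cong (_+ x * (x * x)) (*-assoc 24 x x) ⟩
        24 * (x * x) + x * (x * x)              ≤⟨ +-monoˡ-≤ _ (*-monoˡ-≤ (x * x) (≤x 24)) ⟩
        x * (x * x) + x * (x * x)               ≤⟨ m≤m+n _ (30 * x³) ⟩
        x * (x * x) + x * (x * x) + 30 * x³     ≡⟨ e₂ x ⟩
        32 * x³                                 ∎)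
        where
        e₁ : ∀ a x y → 32 * (3 * a * x + x * y) ≡ 24 * x * (4 * a) + x * (32 * y)
        e₁ = solve-∀
        e₂ : ∀ x → x * (x * x) + x * (x * x) + 30 * (x * x * x) ≡ 32 * (x * x * x)
        e₂ = solve-∀

    Cbound : ℕ
    Cbound = α * α * (α + 3 * q * y) + q * q * κ * (3 * α + q * y)

    [2u+1]xR²≤6qy : ∀ u → suc u * x³ ≤ Cbound → (2 * u + 1) * x * (R * R) ≤ 6 * q * y
    [2u+1]xR²≤6qy u h = +-cancelʳ-≤ (R * R * x) _ _ (subst (_≤ 6 * q * y + R * R * x) (e₀ u x R) (*-cancelʳ-≤ _ _ (x * x) {{>-nonZero 0<x²}} (begin
      2 * suc u * x * (R * R) * (x * x)                             ≡⟨ e₁ u x R ⟩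
      2 * (R * R) * (suc u * x³)                                    ≤⟨ *-monoʳ-≤ (2 * (R * R)) h ⟩
      2 * (R * R) * Cbound                                          ≡⟨ e₂ R α q y κ ⟩
      2 * ((R * α) * (R * α)) * (α + 3 * q * y) + 2 * (R * R) * (3 * α * (q * q * κ) + q * q * q * κ * y)
        ≤⟨ +-mono-≤ (*-monoˡ-≤ (α + 3 * q * y) (*-monoʳ-≤ 2 (square-mono-≤ Rα≤x)))
                    (*-monoʳ-≤ (2 * (R * R)) (+-mono-≤ (*-monoʳ-≤ (3 * α) (<⇒≤ q²κ<x)) (*-monoˡ-≤ y (<⇒≤ q³κ<x)))) ⟩
      2 * (x * x) * (α + 3 * q * y) + 2 * (R * R) * (3 * α * x + x * y) ≡⟨ e₃ x α q y R ⟩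
      6 * q * y * (x * x) + (2 * (x * x) * α + 2 * (R * R) * (x * (3 * α + y))) ≤⟨ +-monoʳ-≤ _ rest≤R²x³ ⟩
      6 * q * y * (x * x) + R * R * x³                              ≡⟨ e₄ q y x R ⟩
      (6 * q * y + R * R * x) * (x * x)                             ∎)))
      where
      e₀ : ∀ u x R → 2 * suc u * x * (R * R) ≡ (2 * u + 1) * x * (R * R) + R * R * x
      e₀ = solve-∀
      e₁ : ∀ u x R → 2 * suc u * x * (R * R) * (x * x) ≡ 2 * (R * R) * (suc u * (x * x * x))
      e₁ = solve-∀
      e₂ : ∀ R a q y k → 2 * (R * R) * (a * a * (a + 3 * q * y) + q * q * k * (3 * a + q * y))
                       ≡ 2 * ((R * a) * (R * a)) * (a + 3 * q * y) + 2 * (R * R) * (3 * a * (q * q * k) + q * q * q * k * y)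
      e₂ = solve-∀
      e₃ : ∀ x a q y R → 2 * (x * x) * (a + 3 * q * y) + 2 * (R * R) * (3 * a * x + x * y)
                       ≡ 6 * q * y * (x * x) + (2 * (x * x) * a + 2 * (R * R) * (x * (3 * a + y)))
      e₃ = solve-∀
      e₄ : ∀ q y x R → 6 * q * y * (x * x) + R * R * (x * x * x) ≡ (6 * q * y + R * R * x) * (x * x)
      e₄ = solve-∀
      4x[3α+y]≤x³ : 4 * (x * (3 * α + y)) ≤ x³
      4x[3α+y]≤x³ = *-cancelˡ-≤ 8 (begin
        8 * (4 * (x * (3 * α + y)))       ≡⟨ e x α y ⟩
        x * (24 * (4 * α) + 32 * y)       ≤⟨ *-monoʳ-≤ x (+-mono-≤ (*-monoʳ-≤ 24 4α≤x) 32y≤x²) ⟩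
        x * (24 * x + x * x)              ≤⟨ *-monoʳ-≤ x (+-monoˡ-≤ (x * x) (*-monoˡ-≤ x (≤x 24))) ⟩
        x * (x * x + x * x)               ≤⟨ m≤m+n _ (6 * x³) ⟩
        x * (x * x + x * x) + 6 * x³      ≡⟨ e′ x ⟩
        8 * x³                            ∎)
        where e : ∀ x a y → 8 * (4 * (x * (3 * a + y))) ≡ x * (24 * (4 * a) + 32 * y)
              e = solve-∀
              e′ : ∀ x → x * (x * x + x * x) + 6 * (x * x * x) ≡ 8 * (x * x * x)
              e′ = solve-∀
      rest≤R²x³ : 2 * (x * x) * α + 2 * (R * R) * (x * (3 * α + y)) ≤ R * R * x³
      rest≤R²x³ = *-cancelˡ-≤ 2 (begin
        2 * (2 * (x * x) * α + 2 * (R * R) * (x * (3 * α + y)))  ≡⟨ e x α R y ⟩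
        x * x * (4 * α) + R * R * (4 * (x * (3 * α + y)))        ≤⟨ +-mono-≤ (*-monoʳ-≤ (x * x) 4α≤x) (*-monoʳ-≤ (R * R) 4x[3α+y]≤x³) ⟩
        x³ + R * R * x³                                          ≤⟨ +-monoˡ-≤ _ (m≤n*m x³ (R * R) {{>-nonZero 0<R²}}) ⟩
        R * R * x³ + R * R * x³                                  ≡⟨ e′ (R * R * x³) ⟩
        2 * (R * R * x³)                                         ∎)
        where
        0<R² = *-mono-< 0<R 0<R
        e : ∀ x a R y → 2 * (2 * (x * x) * a + 2 * (R * R) * (x * (3 * a + y))) ≡ x * x * (4 * a) + R * R * (4 * (x * (3 * a + y)))
        e = solve-∀
        e′ : ∀ Z → Z + Z ≡ 2 * Z
        e′ = solve-∀

    v⁶x⁸≤46656q⁶[x³+κ]³ : ∀ v → v * x * (R * R) ≤ 6 * q * y →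
      v * v * v * v * v * v * x⁸ ≤ 46656 * (q * q * q * q * q * q) * ((x³ + κ) * (x³ + κ) * (x³ + κ))
    v⁶x⁸≤46656q⁶[x³+κ]³ v h = begin
      v * v * v * v * v * v * x⁸                                       ≡⟨ e₁ v x ⟩
      v * v * v * v * v * v * x⁶ * (x * x)                             ≤⟨ *-monoʳ-≤ (v * v * v * v * v * v * x⁶) (square-mono-≤ x≤R⁶) ⟩
      v * v * v * v * v * v * x⁶ * (R * R * R * R * R * R * (R * R * R * R * R * R)) ≡⟨ e₂ v x R ⟩
      (w * w) * (w * w) * (w * w)                                      ≤⟨ cube-mono-≤ w²≤36q²[x³+κ] ⟩
      (36 * (q * q) * (x³ + κ)) * (36 * (q * q) * (x³ + κ)) * (36 * (q * q) * (x³ + κ)) ≡⟨ e₃ q (x³ + κ) ⟩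
      46656 * (q * q * q * q * q * q) * ((x³ + κ) * (x³ + κ) * (x³ + κ)) ∎
      where
      w = v * x * (R * R)
      e₁ : ∀ v x → v * v * v * v * v * v * (x * x * x * x * x * x * x * x) ≡ v * v * v * v * v * v * (x * x * x * x * x * x) * (x * x)
      e₁ = solve-∀
      e₂ : ∀ v x R → v * v * v * v * v * v * (x * x * x * x * x * x) * (R * R * R * R * R * R * (R * R * R * R * R * R))
                   ≡ (v * x * (R * R) * (v * x * (R * R))) * (v * x * (R * R) * (v * x * (R * R))) * (v * x * (R * R) * (v * x * (R * R)))
      e₂ = solve-∀
      e₃ : ∀ q Z → (36 * (q * q) * Z) * (36 * (q * q) * Z) * (36 * (q * q) * Z) ≡ 46656 * (q * q * q * q * q * q) * (Z * Z * Z)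
      e₃ = solve-∀
      w²≤36q²[x³+κ] : w * w ≤ 36 * (q * q) * (x³ + κ)
      w²≤36q²[x³+κ] = begin
        w * w                  ≤⟨ square-mono-≤ h ⟩
        6 * q * y * (6 * q * y) ≡⟨ e q y ⟩
        36 * (q * q) * (y * y)  ≤⟨ *-monoʳ-≤ (36 * (q * q)) y²≤x³+κ ⟩
        36 * (q * q) * (x³ + κ) ∎
        where e : ∀ q y → 6 * q * y * (6 * q * y) ≡ 36 * (q * q) * (y * y)
              e = solve-∀

    -- The bracket is the κ-part of (x³ + κ)³.
    qW<x⁸ : q * (3 * x⁶ * κ + 3 * x³ * (κ * κ) + κ * κ * κ) < x⁸
    qW<x⁸ = begin-strict
      q * (3 * x⁶ * κ + 3 * x³ * (κ * κ) + κ * κ * κ)  ≡⟨ e₁ q x κ ⟩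
      q * κ * M                                          <⟨ *-monoˡ-< M {{>-nonZero 0<M}} qκ<x ⟩
      x * M                                              ≤⟨ *-monoʳ-≤ x M≤x⁷ ⟩
      x * (x * x⁶)                                       ≡⟨ e₂ x ⟩
      x⁸                                                 ∎
      where
      M = 3 * x⁶ + 3 * x³ * κ + κ * κ
      e₁ : ∀ q x k → q * (3 * (x * x * x * x * x * x) * k + 3 * (x * x * x) * (k * k) + k * k * k)
                   ≡ q * k * (3 * (x * x * x * x * x * x) + 3 * (x * x * x) * k + k * k)
      e₁ = solve-∀
      e₂ : ∀ x → x * (x * (x * x * x * x * x * x)) ≡ x * x * x * x * x * x * x * x
      e₂ = solve-∀
      0<M : 0 < M
      0<M = <-≤-trans (*-monoʳ-< 3 0<x⁶) (≤-trans (m≤m+n _ _) (m≤m+n _ _))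
      M≤x⁷ : M ≤ x * x⁶
      M≤x⁷ = begin
        3 * x⁶ + 3 * x³ * κ + κ * κ  ≤⟨ +-mono-≤ (+-monoʳ-≤ _ (*-monoʳ-≤ (3 * x³) κ≤x)) (<⇒≤ κ²<x) ⟩
        3 * x⁶ + 3 * x³ * x + x      ≤⟨ +-mono-≤ (+-monoʳ-≤ _ 3x³x≤3x⁶) x≤x⁶ ⟩
        3 * x⁶ + 3 * x⁶ + x⁶         ≡⟨ e x⁶ ⟩
        7 * x⁶                       ≤⟨ *-monoˡ-≤ x⁶ (≤x 7) ⟩
        x * x⁶                       ∎
        where
        e : ∀ Z → 3 * Z + 3 * Z + Z ≡ 7 * Z
        e = solve-∀
        3x³x≤3x⁶ : 3 * x³ * x ≤ 3 * x⁶
        3x³x≤3x⁶ = subst₂ _≤_ (e′ x) (e″ x) (m≤m*n (3 * (x * x * x * x)) (x * x) {{>-nonZero 0<x²}})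
          where e′ : ∀ x → 3 * (x * x * x * x) ≡ 3 * (x * x * x) * x
                e′ = solve-∀
                e″ : ∀ x → 3 * (x * x * x * x) * (x * x) ≡ 3 * (x * x * x * x * x * x)
                e″ = solve-∀
        x≤x⁶ : x ≤ x⁶
        x≤x⁶ = subst (x ≤_) (e′ x) (m≤m*n x (x * x * x * x * x) {{>-nonZero (*-mono-< 0<x⁴ 0<x)}})
          where e′ : ∀ x → x * (x * x * x * x * x) ≡ x * x * x * x * x * x
                e′ = solve-∀

    -- Raising (2u + 1) x R² ≤ 6 q y to the sixth power gives (2u + 1)⁶ x⁸ ≤ 6⁶ q⁶ (x³ + κ)³; for u > 3 q
    -- the slack 192 u⁵ in (2u + 1)⁶ ≥ 64 u⁶ + 192 u⁵ absorbs the κ-part of (x³ + κ)³.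
    C-bound : ∀ u → x ^ 3 * suc u ≤ Cbound → u ^ 6 < 729 * q ^ 6 * x
    C-bound u h = subst₂ (λ a b → a < 729 * b * x) (sym (^6≡ u)) (sym (^6≡ q)) (bound (u ≤? 3 * q))
      where
      q⁵ = q * q * q * q * q
      q⁶ = q * q * q * q * q * q
      u⁵ = u * u * u * u * u
      u⁶ = u * u * u * u * u * u
      0<q⁵ : 0 < q⁵
      0<q⁵ = *-mono-< (*-mono-< (*-mono-< (*-mono-< 1≤q 1≤q) 1≤q) 1≤q) 1≤q
      bound : Dec (u ≤ 3 * q) → u⁶ < 729 * q⁶ * x
      bound (yes u≤3q) = begin-strict
        u⁶                                                         ≤⟨ pow6-mono-≤ u≤3q ⟩
        3 * q * (3 * q) * (3 * q) * (3 * q) * (3 * q) * (3 * q)    ≡⟨ e q ⟩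
        729 * q⁶ * 1                                               <⟨ *-monoʳ-< (729 * q⁶) {{>-nonZero (*-monoʳ-< 729 (*-mono-< 0<q⁵ 1≤q))}} (≤x 2) ⟩
        729 * q⁶ * x                                               ∎
        where e : ∀ q → 3 * q * (3 * q) * (3 * q) * (3 * q) * (3 * q) * (3 * q) ≡ 729 * (q * q * q * q * q * q) * 1
              e = solve-∀
      bound (no u≰3q) = *-cancelʳ-< (64 * x⁸) u⁶ (729 * q⁶ * x) (+-cancelʳ-< (46656 * q⁵ * x⁸) _ _ (begin-strict
        u⁶ * (64 * x⁸) + 46656 * q⁵ * x⁸                        ≤⟨ +-monoʳ-≤ (u⁶ * (64 * x⁸)) (*-monoˡ-≤ x⁸ 46656q⁵≤192u⁵) ⟩
        u⁶ * (64 * x⁸) + 192 * u⁵ * x⁸                          ≡⟨ e₁ u x⁸ ⟩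
        (64 * u⁶ + 192 * u⁵) * x⁸                               ≤⟨ *-monoˡ-≤ x⁸ 64u⁶+192u⁵≤v⁶ ⟩
        v * v * v * v * v * v * x⁸                              ≤⟨ v⁶x⁸≤46656q⁶[x³+κ]³ v ([2u+1]xR²≤6qy u h′) ⟩
        46656 * q⁶ * ((x³ + κ) * (x³ + κ) * (x³ + κ))           ≡⟨ e₂ q x κ ⟩
        46656 * q⁶ * (x * x⁸) + 46656 * q⁵ * (q * (3 * x⁶ * κ + 3 * x³ * (κ * κ) + κ * κ * κ))
          <⟨ +-monoʳ-< _ (*-monoʳ-< (46656 * q⁵) {{>-nonZero (*-monoʳ-< 46656 0<q⁵)}} qW<x⁸) ⟩
        46656 * q⁶ * (x * x⁸) + 46656 * q⁵ * x⁸                 ≡⟨ cong (_+ 46656 * q⁵ * x⁸) (e₃ q x) ⟩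
        729 * q⁶ * x * (64 * x⁸) + 46656 * q⁵ * x⁸              ∎))
        where
        v = 2 * u + 1
        h′ : suc u * x³ ≤ Cbound
        h′ = subst (_≤ Cbound) (trans (cong (_* suc u) (^3≡ x)) (*-comm x³ (suc u))) h
        46656q⁵≤192u⁵ : 46656 * q⁵ ≤ 192 * u⁵
        46656q⁵≤192u⁵ = begin
          46656 * q⁵                                                ≡⟨ e q ⟩
          192 * (3 * q * (3 * q) * (3 * q) * (3 * q) * (3 * q))     ≤⟨ *-monoʳ-≤ 192 (pow5-mono-≤ (<⇒≤ (≰⇒> u≰3q))) ⟩
          192 * u⁵                                                  ∎
          where e : ∀ q → 46656 * (q * q * q * q * q) ≡ 192 * (3 * q * (3 * q) * (3 * q) * (3 * q) * (3 * q))
                e = solve-∀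
        64u⁶+192u⁵≤v⁶ : 64 * u⁶ + 192 * u⁵ ≤ v * v * v * v * v * v
        64u⁶+192u⁵≤v⁶ = subst (64 * u⁶ + 192 * u⁵ ≤_) (sym (e u)) (m≤m+n _ _)
          where e : ∀ u → (2 * u + 1) * (2 * u + 1) * (2 * u + 1) * (2 * u + 1) * (2 * u + 1) * (2 * u + 1)
                        ≡ 64 * (u * u * u * u * u * u) + 192 * (u * u * u * u * u)
                          + (240 * (u * u * u * u) + 160 * (u * u * u) + 60 * (u * u) + 12 * u + 1)
                e = solve-∀
        e₁ : ∀ u X → u * u * u * u * u * u * (64 * X) + 192 * (u * u * u * u * u) * X
                   ≡ (64 * (u * u * u * u * u * u) + 192 * (u * u * u * u * u)) * X
        e₁ = solve-∀
        e₂ : ∀ q x k → 46656 * (q * q * q * q * q * q) * ((x * x * x + k) * (x * x * x + k) * (x * x * x + k))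
                     ≡ 46656 * (q * q * q * q * q * q) * (x * (x * x * x * x * x * x * x * x))
                       + 46656 * (q * q * q * q * q) * (q * (3 * (x * x * x * x * x * x) * k + 3 * (x * x * x) * (k * k) + k * k * k))
        e₂ = solve-∀
        e₃ : ∀ q x → 46656 * (q * q * q * q * q * q) * (x * (x * x * x * x * x * x * x * x))
                   ≡ 729 * (q * q * q * q * q * q) * x * (64 * (x * x * x * x * x * x * x * x))
        e₃ = solve-∀

    α³y≤x⁴ : α * α * α * y ≤ x⁴
    α³y≤x⁴ = begin
      α * α * α * y                        ≤⟨ *-monoʳ-≤ (α * α * α) y≤xR³ ⟩
      α * α * α * (x * (R * R * R))        ≡⟨ e α x R ⟩
      x * ((R * α) * (R * α) * (R * α))    ≤⟨ *-monoʳ-≤ x (cube-mono-≤ Rα≤x) ⟩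
      x * x³                               ≡⟨ e′ x ⟩
      x⁴                                   ∎
      where e : ∀ a x R → a * a * a * (x * (R * R * R)) ≡ x * ((R * a) * (R * a) * (R * a))
            e = solve-∀
            e′ : ∀ x → x * (x * x * x) ≡ x * x * x * x
            e′ = solve-∀

    -- Of the six terms bounding x⁴ |F| only 4 q α³ y and 4 q⁴ y² κ are of size q x⁴.
    F-bound : ∀ f → x ^ 4 * f ≤ evalAbs F-terms (α ∷ q ∷ y ∷ κ ∷ []) → f < 8 * q + 1
    F-bound f h = *-cancelʳ-< x⁴ f (8 * q + 1) (begin-strict
      f * x⁴                                          ≡⟨ trans (*-comm f x⁴) (cong (_* f) (sym (^4≡ x))) ⟩
      x ^ 4 * f                                       ≤⟨ h ⟩
      T                                               ≤⟨ m≤m+n T (4 * q * x³) ⟩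
      T + 4 * q * x³                                  ≡⟨ e₁ α q y κ x³ ⟩
      4 * q * (α * α * α * y) + (4 * q * q * q * q * y * y * κ + 4 * q * x³) + S
                                                      ≤⟨ +-monoˡ-≤ S (+-mono-≤ (*-monoʳ-≤ (4 * q) α³y≤x⁴) q⁴y²κ-term) ⟩
      4 * q * x⁴ + (4 * q * x⁴ + 4 * q * x * κ + 4 * q * κ) + S ≡⟨ e₂ q x⁴ x κ S ⟩
      8 * q * x⁴ + (S + (4 * q * x * κ + 4 * q * κ))  <⟨ +-monoʳ-< (8 * q * x⁴) small<x⁴ ⟩
      8 * q * x⁴ + x⁴                                 ≡⟨ e₃ q x⁴ ⟩
      (8 * q + 1) * x⁴                                ∎)
      where
      T = 1 * α * α * α * α + 4 * α * α * α * q * y + 6 * α * α * q * q * κ + 4 * α * q * q * q * y * κ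
          + 4 * q * q * q * q * y * y * κ + 3 * q * q * q * q * κ * κ
      S = α * α * α * α + 6 * α * α * q * q * κ + 4 * α * q * q * q * y * κ + 3 * q * q * q * q * κ * κ
      e₁ : ∀ a q y k X → 1 * a * a * a * a + 4 * a * a * a * q * y + 6 * a * a * q * q * k + 4 * a * q * q * q * y * k
                         + 4 * q * q * q * q * y * y * k + 3 * q * q * q * q * k * k + 4 * q * X
                       ≡ 4 * q * (a * a * a * y) + (4 * q * q * q * q * y * y * k + 4 * q * X)
                         + (a * a * a * a + 6 * a * a * q * q * k + 4 * a * q * q * q * y * k + 3 * q * q * q * q * k * k)
      e₁ = solve-∀
      e₂ : ∀ q X x k C → 4 * q * X + (4 * q * X + 4 * q * x * k + 4 * q * k) + C ≡ 8 * q * X + (C + (4 * q * x * k + 4 * q * k))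
      e₂ = solve-∀
      e₃ : ∀ q X → 8 * q * X + X ≡ (8 * q + 1) * X
      e₃ = solve-∀
      q⁴y²κ-term : 4 * q * q * q * q * y * y * κ + 4 * q * x³ ≤ 4 * q * x⁴ + 4 * q * x * κ + 4 * q * κ
      q⁴y²κ-term = begin
        4 * q * q * q * q * y * y * κ + 4 * q * x³         ≤⟨ +-monoʳ-≤ _ (*-monoʳ-≤ (4 * q) x³≤y²+κ) ⟩
        4 * q * q * q * q * y * y * κ + 4 * q * (y * y + κ) ≡⟨ e q y κ ⟩
        4 * q * (y * y) * (q * q * q * κ + 1) + 4 * q * κ   ≤⟨ +-monoˡ-≤ _ (*-monoʳ-≤ (4 * q * (y * y)) (subst (_≤ x) (+-comm 1 _) q³κ<x)) ⟩
        4 * q * (y * y) * x + 4 * q * κ                     ≤⟨ +-monoˡ-≤ _ (*-monoˡ-≤ x (*-monoʳ-≤ (4 * q) y²≤x³+κ)) ⟩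
        4 * q * (x³ + κ) * x + 4 * q * κ                    ≡⟨ e′ q x κ ⟩
        4 * q * x⁴ + 4 * q * x * κ + 4 * q * κ              ∎
        where e : ∀ q y k → 4 * q * q * q * q * y * y * k + 4 * q * (y * y + k) ≡ 4 * q * (y * y) * (q * q * q * k + 1) + 4 * q * k
              e = solve-∀
              e′ : ∀ q x k → 4 * q * (x * x * x + k) * x + 4 * q * k ≡ 4 * q * (x * x * x * x) + 4 * q * x * k + 4 * q * k
              e′ = solve-∀
      small<x⁴ : S + (4 * q * x * κ + 4 * q * κ) < x⁴
      small<x⁴ = *-cancelˡ-< 256 _ _ (≤-<-trans 256small≤12x⁴ (*-monoˡ-< x⁴ {{>-nonZero 0<x⁴}} (literal {13} {256})))
        where
        256small≤12x⁴ : 256 * (S + (4 * q * x * κ + 4 * q * κ)) ≤ 12 * x⁴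
        256small≤12x⁴ = begin
          256 * (S + (4 * q * x * κ + 4 * q * κ))                                  ≡⟨ e α q κ y x ⟩
          (4 * α) * (4 * α) * (4 * α) * (4 * α) + 96 * ((4 * α) * (4 * α)) * (q * q * κ)
            + 8 * ((4 * α) * (32 * y)) * (q * q * q * κ) + 768 * (q * q * q * κ) * (q * κ) + 1024 * (q * κ) * (x + 1)
            ≤⟨ +-mono-≤ (+-mono-≤ (+-mono-≤ (+-mono-≤ (pow4-mono-≤ 4α≤x)
                         (*-mono-≤ (*-monoʳ-≤ 96 (square-mono-≤ 4α≤x)) (<⇒≤ q²κ<x)))
                         (*-mono-≤ (*-monoʳ-≤ 8 (*-mono-≤ 4α≤x 32y≤x²)) (<⇒≤ q³κ<x)))
                         (*-mono-≤ (*-monoʳ-≤ 768 (<⇒≤ q³κ<x)) (<⇒≤ qκ<x)))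
                         (*-monoˡ-≤ (x + 1) (*-monoʳ-≤ 1024 (<⇒≤ qκ<x))) ⟩
          x * x * x * x + 96 * (x * x) * x + 8 * (x * (x * x)) * x + 768 * x * x + 1024 * x * (x + 1)
                                                                                  ≡⟨ e′ x ⟩
          9 * x⁴ + (96 * x³ + 1792 * (x * x) + 1024 * x)                          ≤⟨ +-monoʳ-≤ (9 * x⁴) lower≤3x⁴ ⟩
          9 * x⁴ + 3 * x⁴                                                         ≡⟨ e″ x⁴ ⟩
          12 * x⁴                                                                 ∎
          where
          e : ∀ a q k y x → 256 * (a * a * a * a + 6 * a * a * q * q * k + 4 * a * q * q * q * y * k + 3 * q * q * q * q * k * k
                                   + (4 * q * x * k + 4 * q * k))
                          ≡ (4 * a) * (4 * a) * (4 * a) * (4 * a) + 96 * ((4 * a) * (4 * a)) * (q * q * k)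
                            + 8 * ((4 * a) * (32 * y)) * (q * q * q * k) + 768 * (q * q * q * k) * (q * k) + 1024 * (q * k) * (x + 1)
          e = solve-∀
          e′ : ∀ x → x * x * x * x + 96 * (x * x) * x + 8 * (x * (x * x)) * x + 768 * x * x + 1024 * x * (x + 1)
                   ≡ 9 * (x * x * x * x) + (96 * (x * x * x) + 1792 * (x * x) + 1024 * x)
          e′ = solve-∀
          e″ : ∀ X → 9 * X + 3 * X ≡ 12 * X
          e″ = solve-∀
          x≤x² = m≤m*n x x {{>-nonZero 0<x}}
          lower≤3x⁴ : 96 * x³ + 1792 * (x * x) + 1024 * x ≤ 3 * x⁴
          lower≤3x⁴ = begin
            96 * x³ + 1792 * (x * x) + 1024 * x
              ≤⟨ +-mono-≤ (+-mono-≤ (*-monoˡ-≤ x³ (≤x 96)) (*-monoˡ-≤ (x * x) (≤-trans (≤x 1792) x≤x²)))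
                          (*-monoˡ-≤ x (≤-trans (≤x 1024) (≤-trans x≤x² (m≤m*n (x * x) x {{>-nonZero 0<x}})))) ⟩
            x * x³ + x * x * (x * x) + x * x * x * x     ≡⟨ e‴ x ⟩
            3 * x⁴                                       ∎
            where e‴ : ∀ x → x * (x * x * x) + x * x * (x * x) + x * x * x * x ≡ 3 * (x * x * x * x)
                  e‴ = solve-∀

    y³κ≤x⁵ : y * y * y * κ ≤ x⁵
    y³κ≤x⁵ = square-cancel-≤ (begin
       y * y * y * κ * (y * y * y * κ) ≡⟨ e1 y κ ⟩
       (y * y) * (y * y) * (y * y) * (κ * κ) ≤⟨ *-monoˡ-≤ (κ * κ) (cube-mono-≤ y²≤x³+κ) ⟩
       P3 * (κ * κ) ≤⟨ +-cancelʳ-≤ (x * x * x * x * x * x * x * x * x) _ _ st ⟩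
       x⁵ * x⁵ ∎)
      where
        P3 = (x * x * x + κ) * (x * x * x + κ) * (x * x * x + κ)
        W = 3 * (x * x * x * x * x * x) * κ + 3 * (x * x * x) * (κ * κ) + κ * κ * κ
        e1 : ∀ y k → y * y * y * k * (y * y * y * k) ≡ (y * y) * (y * y) * (y * y) * (k * k)
        e1 = solve-∀
        Wle : W ≤ x * x * x * x * x * x * x * x
        Wle = ≤-trans (m≤n*m W q {{>-nonZero 1≤q}}) (<⇒≤ qW<x⁸)
        st : P3 * (κ * κ) + x * x * x * x * x * x * x * x * x ≤ x⁵ * x⁵ + x * x * x * x * x * x * x * x * x
        st = begin
          P3 * (κ * κ) + x * x * x * x * x * x * x * x * x ≤⟨ +-monoʳ-≤ (P3 * (κ * κ)) (≤-trans (m≤m+n _ W) (≤-reflexive (e2 x κ))) ⟩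
          P3 * (κ * κ) + P3 ≡⟨ e3 P3 (κ * κ) ⟩
          P3 * (κ * κ + 1) ≤⟨ *-monoʳ-≤ P3 (subst (_≤ x) (+-comm 1 _) κ²<x) ⟩
          P3 * x ≡⟨ e4 x κ ⟩
          x⁵ * x⁵ + x * W ≤⟨ +-monoʳ-≤ (x⁵ * x⁵) (*-monoʳ-≤ x Wle) ⟩
          x⁵ * x⁵ + x * (x * x * x * x * x * x * x * x) ≡⟨ cong (x⁵ * x⁵ +_) (e5 x) ⟩
          x⁵ * x⁵ + x * x * x * x * x * x * x * x * x ∎
          where
            e2 : ∀ x k → x * x * x * x * x * x * x * x * x + (3 * (x * x * x * x * x * x) * k + 3 * (x * x * x) * (k * k) + k * k * k) ≡ (x * x * x + k) * (x * x * x + k) * (x * x * x + k)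
            e2 = solve-∀
            e3 : ∀ P K → P * K + P ≡ P * (K + 1)
            e3 = solve-∀
            e4 : ∀ x k → (x * x * x + k) * (x * x * x + k) * (x * x * x + k) * x ≡ x * x * x * x * x * (x * x * x * x * x) + x * (3 * (x * x * x * x * x * x) * k + 3 * (x * x * x) * (k * k) + k * k * k)
            e4 = solve-∀
            e5 : ∀ x → x * (x * x * x * x * x * x * x * x) ≡ x * x * x * x * x * x * x * x * x
            e5 = solve-∀

    remaining-terms<x⁶ : α * α * α * α * α * α + 15 * α * α * α * α * q * q * κ + 20 * α * α * α * q * q * q * y * κ + 28 * q * q * q * q * q * q * y * y * κ * κ + 27 * q * q * q * q * q * q * κ * κ * κ < x⁶
    remaining-terms<x⁶ = *-cancelˡ-< 4096 _ _ (begin-strict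
      4096 * (α * α * α * α * α * α + 15 * α * α * α * α * q * q * κ + 20 * α * α * α * q * q * q * y * κ + 28 * q * q * q * q * q * q * y * y * κ * κ + 27 * q * q * q * q * q * q * κ * κ * κ) ≡⟨ e1 α q y κ ⟩
      (4 * α) * (4 * α) * (4 * α) * (4 * α) * (4 * α) * (4 * α) + 4096 * (15 * (α * α * α * α) * (q * q * κ) + 20 * (α * α * α * y) * (q * q * q * κ) + 28 * (q * q * q * q * q * q) * (y * y) * (κ * κ) + 27 * (q * q * q * q * q * q) * (κ * κ * κ))
        ≤⟨ +-mono-≤ (pow6-mono-≤ 4α≤x) (*-monoʳ-≤ 4096 (+-mono-≤ (+-mono-≤ (+-mono-≤ (*-mono-≤ (*-monoʳ-≤ 15 (pow4-mono-≤ α≤x)) (<⇒≤ q²κ<x)) (*-mono-≤ (*-monoʳ-≤ 20 α³y≤x⁴) (<⇒≤ q³κ<x))) (*-mono-≤ (*-mono-≤ (*-monoʳ-≤ 28 (<⇒≤ q⁶<x)) (≤-trans y²≤x³+κ (+-monoʳ-≤ x³ (≤-trans κ≤x x≤x³)))) (<⇒≤ κ²<x))) (*-mono-≤ (*-monoʳ-≤ 27 (<⇒≤ q⁶<x)) (cube-mono-≤ κ≤x)))) ⟩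
      x * x * x * x * x * x + 4096 * (15 * (x * x * x * x) * x + 20 * x⁴ * x + 28 * x * (x³ + x³) * x + 27 * x * (x * x * x)) ≡⟨ cong (x⁶ +_) (cong (4096 *_) (e2 x)) ⟩
      x⁶ + 4096 * (91 * x⁵ + 27 * x⁴) ≤⟨ +-monoʳ-≤ x⁶ (*-monoʳ-≤ 4096 (+-monoʳ-≤ (91 * x⁵) (*-monoʳ-≤ 27 x⁴≤x⁵))) ⟩
      x⁶ + 4096 * (91 * x⁵ + 27 * x⁵) ≡⟨ cong (x⁶ +_) (e3 x⁵) ⟩
      x⁶ + 118 * (4096 * x⁵) ≤⟨ +-monoʳ-≤ x⁶ (*-monoʳ-≤ 118 (*-monoˡ-≤ x⁵ 4096≤x)) ⟩
      x⁶ + 118 * (x * x⁵) ≡⟨ e4 x ⟩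
      119 * x⁶ <⟨ *-monoˡ-< x⁶ {{>-nonZero 0<x⁶}} (literal {120} {4096}) ⟩
      4096 * x⁶ ∎)
      where
        e1 : ∀ a q y k → 4096 * (a * a * a * a * a * a + 15 * a * a * a * a * q * q * k + 20 * a * a * a * q * q * q * y * k + 28 * q * q * q * q * q * q * y * y * k * k + 27 * q * q * q * q * q * q * k * k * k) ≡ (4 * a) * (4 * a) * (4 * a) * (4 * a) * (4 * a) * (4 * a) + 4096 * (15 * (a * a * a * a) * (q * q * k) + 20 * (a * a * a * y) * (q * q * q * k) + 28 * (q * q * q * q * q * q) * (y * y) * (k * k) + 27 * (q * q * q * q * q * q) * (k * k * k))
        e1 = solve-∀
        e2 : ∀ x → 15 * (x * x * x * x) * x + 20 * (x * x * x * x) * x + 28 * x * (x * x * x + x * x * x) * x + 27 * x * (x * x * x) ≡ 91 * (x * x * x * x * x) + 27 * (x * x * x * x)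
        e2 = solve-∀
        e3 : ∀ X → 4096 * (91 * X + 27 * X) ≡ 118 * (4096 * X)
        e3 = solve-∀
        e4 : ∀ x → x * x * x * x * x * x + 118 * (x * (x * x * x * x * x)) ≡ 119 * (x * x * x * x * x * x)
        e4 = solve-∀



    middle-terms≤72q⁴αx⁵ : 6 * α * α * α * α * α * q * y + 60 * α * α * q * q * q * q * y * y * κ + 45 * α * α * q * q * q * q * κ * κ + 66 * α * q * q * q * q * q * y * κ * κ ≤ 72 * q⁴ * α * x⁵
    middle-terms≤72q⁴αx⁵ = begin
      6 * α * α * α * α * α * q * y + 60 * α * α * q * q * q * q * y * y * κ + 45 * α * α * q * q * q * q * κ * κ + 66 * α * q * q * q * q * q * y * κ * κ ≡⟨ e₁ α q y κ ⟩
      6 * α * α * α * α * α * q * y + q⁴ * α * (60 * (α * (y * y) * κ)) + q⁴ * α * (45 * (α * (κ * κ))) + q⁴ * α * (66 * (q * y * (κ * κ)))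
         ≤⟨ +-mono-≤ (+-mono-≤ (+-mono-≤ 6α⁵qy≤6q⁴αx⁵ (*-monoʳ-≤ (q⁴ * α) 60αy²κ≤x⁵)) (*-monoʳ-≤ (q⁴ * α) 45ακ²≤x⁵)) (*-monoʳ-≤ (q⁴ * α) 66qyκ²≤x⁵) ⟩
      q⁴ * α * x⁵ * 6 + q⁴ * α * x⁵ + q⁴ * α * x⁵ + q⁴ * α * x⁵ ≡⟨ e₂ (q⁴ * α * x⁵) ⟩
      9 * (q⁴ * α * x⁵) ≤⟨ *-monoˡ-≤ (q⁴ * α * x⁵) (literal {9} {72}) ⟩
      72 * (q⁴ * α * x⁵) ≡⟨ e₃ q⁴ α x⁵ ⟩
      72 * q⁴ * α * x⁵ ∎
      where
        1≤q⁴ : 1 ≤ q⁴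
        1≤q⁴ = *-mono-≤ (*-mono-≤ (*-mono-≤ 1≤q 1≤q) 1≤q) 1≤q
        e₁ : ∀ a q y k → 6 * a * a * a * a * a * q * y + 60 * a * a * q * q * q * q * y * y * k + 45 * a * a * q * q * q * q * k * k + 66 * a * q * q * q * q * q * y * k * k ≡ 6 * a * a * a * a * a * q * y + q * q * q * q * a * (60 * (a * (y * y) * k)) + q * q * q * q * a * (45 * (a * (k * k))) + q * q * q * q * a * (66 * (q * y * (k * k)))
        e₁ = solve-∀
        e₂ : ∀ Z → Z * 6 + Z + Z + Z ≡ 9 * Z
        e₂ = solve-∀
        e₃ : ∀ Q a X → 72 * (Q * a * X) ≡ 72 * Q * a * X
        e₃ = solve-∀
        Rα⁴y≤x⁵ : R * (α * α * α * α * y) ≤ x⁵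
        Rα⁴y≤x⁵ = *-cancelʳ-≤ _ _ (R * R * R) {{>-nonZero 0<R³}} (begin
          R * (α * α * α * α * y) * (R * R * R) ≡⟨ e1 R α y ⟩
          (R * α) * (R * α) * (R * α) * (R * α) * y ≤⟨ *-monoˡ-≤ y (*-mono-≤ (cube-mono-≤ Rα≤x) Rα≤x) ⟩
          x * x * x * x * y ≤⟨ *-monoʳ-≤ (x * x * x * x) y≤xR³ ⟩
          x * x * x * x * (x * (R * R * R)) ≡⟨ e2 x R ⟩
          x⁵ * (R * R * R) ∎)
          where
            e1 : ∀ R a y → R * (a * a * a * a * y) * (R * R * R) ≡ (R * a) * (R * a) * (R * a) * (R * a) * y
            e1 = solve-∀
            e2 : ∀ x R → x * x * x * x * (x * (R * R * R)) ≡ x * x * x * x * x * (R * R * R)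
            e2 = solve-∀

        6α⁵qy≤6q⁴αx⁵ : 6 * α * α * α * α * α * q * y ≤ q⁴ * α * x⁵ * 6
        6α⁵qy≤6q⁴αx⁵ = begin
          6 * α * α * α * α * α * q * y ≤⟨ *-cancelˡ-≤ R {{>-nonZero 0<R}} b ⟩
          6 * α * x⁵ ≡⟨ e2 α x⁵ ⟩
          1 * α * x⁵ * 6 ≤⟨ *-monoˡ-≤ 6 (*-monoˡ-≤ x⁵ (*-monoˡ-≤ α 1≤q⁴)) ⟩
          q⁴ * α * x⁵ * 6 ∎
          where
            e2 : ∀ a X → 6 * a * X ≡ 1 * a * X * 6
            e2 = solve-∀
            b : R * (6 * α * α * α * α * α * q * y) ≤ R * (6 * α * x⁵)
            b = begin
              R * (6 * α * α * α * α * α * q * y) ≡⟨ e1 R α q y ⟩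
              6 * q * α * (R * (α * α * α * α * y)) ≤⟨ *-monoʳ-≤ (6 * q * α) Rα⁴y≤x⁵ ⟩
              6 * q * α * x⁵ ≤⟨ *-monoˡ-≤ x⁵ (*-monoˡ-≤ α (*-monoʳ-≤ 6 (<⇒≤ q<R))) ⟩
              6 * R * α * x⁵ ≡⟨ e3 R α x⁵ ⟩
              R * (6 * α * x⁵) ∎
              where
                e1 : ∀ R a q y → R * (6 * a * a * a * a * a * q * y) ≡ 6 * q * a * (R * (a * a * a * a * y))
                e1 = solve-∀
                e3 : ∀ R a X → 6 * R * a * X ≡ R * (6 * a * X)
                e3 = solve-∀

        60αy²κ≤x⁵ : 60 * (α * (y * y) * κ) ≤ x⁵
        60αy²κ≤x⁵ = *-cancelˡ-≤ 256 (begin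
          256 * (60 * (α * (y * y) * κ)) ≤⟨ *-monoʳ-≤ 256 (*-monoˡ-≤ (α * (y * y) * κ) (literal {60} {64})) ⟩
          256 * (64 * (α * (y * y) * κ)) ≡⟨ e1 α y κ ⟩
          64 * ((4 * α) * (64 * κ) * (y * y)) ≤⟨ *-monoʳ-≤ 64 (*-mono-≤ (*-mono-≤ 4α≤x 64κ≤x) y²≤x³+κ) ⟩
          64 * (x * x * (x³ + κ)) ≤⟨ *-monoʳ-≤ 64 (*-monoʳ-≤ (x * x) (+-monoʳ-≤ x³ (≤-trans κ≤x x≤x³))) ⟩
          64 * (x * x * (x³ + x³)) ≡⟨ e2 x ⟩
          128 * x⁵ ≤⟨ *-monoˡ-≤ x⁵ (literal {128} {256}) ⟩
          256 * x⁵ ∎)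
          where
            e1 : ∀ a y k → 256 * (64 * (a * (y * y) * k)) ≡ 64 * ((4 * a) * (64 * k) * (y * y))
            e1 = solve-∀
            e2 : ∀ x → 64 * (x * x * (x * x * x + x * x * x)) ≡ 128 * (x * x * x * x * x)
            e2 = solve-∀

        45ακ²≤x⁵ : 45 * (α * (κ * κ)) ≤ x⁵
        45ακ²≤x⁵ = begin
          45 * (α * (κ * κ)) ≤⟨ *-monoʳ-≤ 45 (*-mono-≤ α≤x (<⇒≤ κ²<x)) ⟩
          45 * (x * x) ≤⟨ *-monoˡ-≤ (x * x) (≤x 45) ⟩
          x * (x * x) ≤⟨ ≤-reflexive (sym (*-assoc x x x)) ⟩
          x³ ≤⟨ m≤m*n x³ x {{>-nonZero 0<x}} ⟩
          x⁴ ≤⟨ x⁴≤x⁵ ⟩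
          x⁵ ∎

        66qyκ²≤x⁵ : 66 * (q * y * (κ * κ)) ≤ x⁵
        66qyκ²≤x⁵ = begin
          66 * (q * y * (κ * κ)) ≡⟨ e1 q y κ ⟩
          66 * ((q * κ) * y * κ) ≤⟨ *-monoʳ-≤ 66 (*-mono-≤ (*-mono-≤ (<⇒≤ qκ<x) (≤-trans (m≤n*m y 32) 32y≤x²)) κ≤x) ⟩
          66 * (x * (x * x) * x) ≡⟨ e2 x ⟩
          66 * x⁴ ≤⟨ *-monoˡ-≤ x⁴ (≤x 66) ⟩
          x * x⁴ ≡⟨ *-comm x x⁴ ⟩
          x⁵ ∎
          where
            e1 : ∀ q y k → 66 * (q * y * (k * k)) ≡ 66 * ((q * k) * y * k)
            e1 = solve-∀
            e2 : ∀ x → 66 * (x * (x * x) * x) ≡ 66 * (x * x * x * x)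
            e2 = solve-∀

    -- The only term of size q⁴ x⁶ is 72 α q⁵ y³ κ, and it comes with the factor q α < R α ≤ x.
    H-bound : ∀ h → x ^ 6 * h ≤ evalAbs H-terms (α ∷ q ∷ y ∷ κ ∷ []) → h < 72 * q ^ 4 + 1
    H-bound h hh = subst (λ c → h < 72 * c + 1) (sym (^4≡ q)) (*-cancelʳ-< x⁶ h (72 * q⁴ + 1) (+-cancelʳ-< (72 * q⁴ * α * x⁵) _ _ (begin-strict
      h * x⁶ + 72 * q⁴ * α * x⁵ ≡⟨ cong (_+ 72 * q⁴ * α * x⁵) (trans (*-comm h x⁶) (cong (_* h) (sym (^6≡ x)))) ⟩
      x ^ 6 * h + 72 * q⁴ * α * x⁵ ≤⟨ +-monoˡ-≤ (72 * q⁴ * α * x⁵) hh ⟩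
      Us + 72 * q⁴ * α * x⁵ ≡⟨ e₁ α q y κ (72 * q⁴ * α * x⁵) ⟩
      (72 * α * q * q * q * q * q * y * y * y * κ + 72 * q⁴ * α * x⁵) + A' + B' ≤⟨ +-monoˡ-≤ B' (+-mono-≤ dominant-term middle-terms≤72q⁴αx⁵) ⟩
      72 * q⁴ * x⁶ + 72 * q⁴ * α * x⁵ + B' <⟨ +-monoʳ-< _ remaining-terms<x⁶ ⟩
      72 * q⁴ * x⁶ + 72 * q⁴ * α * x⁵ + x⁶ ≡⟨ e₂ q⁴ x⁶ (72 * q⁴ * α * x⁵) ⟩
      (72 * q⁴ + 1) * x⁶ + 72 * q⁴ * α * x⁵ ∎)))
      where
        Us = 1 * α * α * α * α * α * α + 6 * α * α * α * α * α * q * y + 15 * α * α * α * α * q * q * κ + 20 * α * α * α * q * q * q * y * κ + 60 * α * α * q * q * q * q * y * y * κ + 45 * α * α * q * q * q * q * κ * κ + 72 * α * q * q * q * q * q * y * y * y * κ + 66 * α * q * q * q * q * q * y * κ * κ + 28 * q * q * q * q * q * q * y * y * κ * κ + 27 * q * q * q * q * q * q * κ * κ * κ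
        A' = 6 * α * α * α * α * α * q * y + 60 * α * α * q * q * q * q * y * y * κ + 45 * α * α * q * q * q * q * κ * κ + 66 * α * q * q * q * q * q * y * κ * κ
        B' = α * α * α * α * α * α + 15 * α * α * α * α * q * q * κ + 20 * α * α * α * q * q * q * y * κ + 28 * q * q * q * q * q * q * y * y * κ * κ + 27 * q * q * q * q * q * q * κ * κ * κ
        e₁ : ∀ a q y k T → 1 * a * a * a * a * a * a + 6 * a * a * a * a * a * q * y + 15 * a * a * a * a * q * q * k + 20 * a * a * a * q * q * q * y * k + 60 * a * a * q * q * q * q * y * y * k + 45 * a * a * q * q * q * q * k * k + 72 * a * q * q * q * q * q * y * y * y * k + 66 * a * q * q * q * q * q * y * k * k + 28 * q * q * q * q * q * q * y * y * k * k + 27 * q * q * q * q * q * q * k * k * k + T ≡ (72 * a * q * q * q * q * q * y * y * y * k + T) + (6 * a * a * a * a * a * q * y + 60 * a * a * q * q * q * q * y * y * k + 45 * a * a * q * q * q * q * k * k + 66 * a * q * q * q * q * q * y * k * k) + (a * a * a * a * a * a + 15 * a * a * a * a * q * q * k + 20 * a * a * a * q * q * q * y * k + 28 * q * q * q * q * q * q * y * y * k * k + 27 * q * q * q * q * q * q * k * k * k)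
        e₁ = solve-∀
        e₂ : ∀ Q X T → 72 * Q * X + T + X ≡ (72 * Q + 1) * X + T
        e₂ = solve-∀
        dominant-term : 72 * α * q * q * q * q * q * y * y * y * κ + 72 * q⁴ * α * x⁵ ≤ 72 * q⁴ * x⁶
        dominant-term = begin
          72 * α * q * q * q * q * q * y * y * y * κ + 72 * q⁴ * α * x⁵ ≡⟨ e1 α q y κ x⁵ ⟩
          72 * q⁴ * (q * α * (y * y * y * κ) + α * x⁵) ≤⟨ *-monoʳ-≤ (72 * q⁴) (+-monoˡ-≤ (α * x⁵) (*-monoʳ-≤ (q * α) y³κ≤x⁵)) ⟩
          72 * q⁴ * (q * α * x⁵ + α * x⁵) ≡⟨ e2 q⁴ q α x⁵ ⟩
          72 * q⁴ * (suc q * α) * x⁵ ≤⟨ *-monoˡ-≤ x⁵ (*-monoʳ-≤ (72 * q⁴) (≤-trans (*-monoˡ-≤ α q<R) Rα≤x)) ⟩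
          72 * q⁴ * x * x⁵ ≡⟨ e3 q⁴ x ⟩
          72 * q⁴ * x⁶ ∎
          where
            e1 : ∀ a q y k X → 72 * a * q * q * q * q * q * y * y * y * k + 72 * (q * q * q * q) * a * X ≡ 72 * (q * q * q * q) * (q * a * (y * y * y * k) + a * X)
            e1 = solve-∀
            e2 : ∀ Q q a X → 72 * Q * (q * a * X + a * X) ≡ 72 * Q * (suc q * a) * X
            e2 = solve-∀
            e3 : ∀ Q x → 72 * Q * x * (x * x * x * x * x) ≡ 72 * Q * (x * x * x * x * x * x)
            e3 = solve-∀

module Dirichlet where

  open import Data.Nat
  open import Data.Nat.Properties
  open import Data.Nat.DivMod
  open import Data.Nat.Tactic.RingSolver using (solve-∀)
  open import Data.Fin using (Fin; toℕ; fromℕ<)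
  open import Data.Fin.Properties using (pigeonhole; fromℕ<-injective; toℕ<n)
  open import Data.Product using (∃₂; _×_; _,_)
  open import Data.Sum using ([_,_]′)
  open import Data.Empty using (⊥-elim)
  open import Relation.Binary.PropositionalEquality
  open import Relation.Nullary using (Dec; yes; no; ¬_)

  m+n≡o+p⇒∣m-o∣≡∣p-n∣ : ∀ m {n} o {p} → m + n ≡ o + p → ∣ m - o ∣ ≡ ∣ p - n ∣
  m+n≡o+p⇒∣m-o∣≡∣p-n∣ m {n} o {p} eq = begin
    ∣ m - o ∣         ≡⟨ sym (∣m+n-m+o∣≡∣n-o∣ n m o) ⟩
    ∣ n + m - n + o ∣ ≡⟨ cong₂ ∣_-_∣ (+-comm n m) (+-comm n o) ⟩
    ∣ m + n - o + n ∣ ≡⟨ cong (∣_- o + n ∣) eq ⟩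
    ∣ o + p - o + n ∣ ≡⟨ ∣m+n-m+o∣≡∣n-o∣ o p n ⟩
    ∣ p - n ∣         ∎
    where open ≡-Reasoning

  ∣m-n∣<o : ∀ {m n o} → m < o → n < o → ∣ m - n ∣ < o
  ∣m-n∣<o {m} {n} m<o n<o = [ (λ eq → subst (_< _) (sym eq) (≤-<-trans (m∸n≤m m n) m<o))
                            , (λ eq → subst (_< _) (sym eq) (≤-<-trans (m∸n≤m n m) n<o)) ]′
                            (∣m-n∣≡[m∸n]∨[n∸m] m n)

  m/n≡o/n⇒∣m-o∣<n : ∀ m o n .{{_ : NonZero n}} → m / n ≡ o / n → ∣ m - o ∣ < n
  m/n≡o/n⇒∣m-o∣<n m o n eq =
    subst (_< n) (sym (m+n≡o+p⇒∣m-o∣≡∣p-n∣ m o same)) (∣m-n∣<o (m%n<n m n) (m%n<n o n))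
    where
    same : m + o % n ≡ o + m % n
    same = begin
      m + o % n                       ≡⟨ cong (_+ o % n) (m≡m%n+[m/n]*n m n) ⟩
      m % n + m / n * n + o % n       ≡⟨ cong (λ c → m % n + c * n + o % n) eq ⟩
      m % n + o / n * n + o % n       ≡⟨ swap-ends (m % n) (o / n * n) (o % n) ⟩
      o % n + o / n * n + m % n       ≡⟨ cong (_+ m % n) (sym (m≡m%n+[m/n]*n o n)) ⟩
      o + m % n                       ∎
      where
      open ≡-Reasoning
      swap-ends : ∀ a b c → a + b + c ≡ c + b + a
      swap-ends = solve-∀

  -- Pigeonhole on the residues j y mod x (0 ≤ j ≤ Q) in the Q + 1 windows of width x / (Q + 1),
  -- with the point x added as a sentinel in the last window.
  module _ (x y Q : ℕ) .{{_ : NonZero x}} (1≤Q : 1 ≤ Q) where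

    private
      R = suc Q
      r : ℕ → ℕ
      r j = j * y % x
      d : ℕ → ℕ
      d j = j * y / x
      window : ℕ → ℕ
      window j = R * r j / x

      window<R : ∀ j → window j < R
      window<R j = m<n*o⇒m/o<n (*-monoʳ-< R (m%n<n (j * y) x))

      Approx : Set
      Approx = ∃₂ λ p q → 1 ≤ q × q ≤ Q × R * ∣ p * x - q * y ∣ ≤ x

      sameWindow : ∀ {a b} → a < b → b ≤ Q → window a ≡ window b → Approx
      sameWindow {a} {b} a<b b≤Q eq = d b ∸ d a , b ∸ a , m<n⇒0<n∸m a<b , ≤-trans (m∸n≤m b a) b≤Q , close
        where
        da≤db : d a ≤ d b
        da≤db = /-monoˡ-≤ x (*-monoˡ-≤ y (<⇒≤ a<b))
        cross : (d b ∸ d a) * x + r b ≡ (b ∸ a) * y + r a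
        cross = +-cancelʳ-≡ (d a * x) _ _ (begin
          (d b ∸ d a) * x + r b + d a * x  ≡⟨ regroup (d b ∸ d a) x (r b) (d a) ⟩
          r b + (d b ∸ d a + d a) * x      ≡⟨ cong (λ c → r b + c * x) (m∸n+n≡m da≤db) ⟩
          r b + d b * x                    ≡⟨ sym (m≡m%n+[m/n]*n (b * y) x) ⟩
          b * y                            ≡⟨ cong (_* y) (sym (m∸n+n≡m (<⇒≤ a<b))) ⟩
          (b ∸ a + a) * y                  ≡⟨ *-distribʳ-+ y (b ∸ a) a ⟩
          (b ∸ a) * y + a * y              ≡⟨ cong ((b ∸ a) * y +_) (m≡m%n+[m/n]*n (a * y) x) ⟩
          (b ∸ a) * y + (r a + d a * x)    ≡⟨ sym (+-assoc ((b ∸ a) * y) (r a) (d a * x)) ⟩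
          (b ∸ a) * y + r a + d a * x      ∎)
          where
          open ≡-Reasoning
          regroup : ∀ p x s d → p * x + s + d * x ≡ s + (p + d) * x
          regroup = solve-∀
        close : R * ∣ (d b ∸ d a) * x - (b ∸ a) * y ∣ ≤ x
        close = begin
          R * ∣ (d b ∸ d a) * x - (b ∸ a) * y ∣ ≡⟨ cong (R *_) (m+n≡o+p⇒∣m-o∣≡∣p-n∣ ((d b ∸ d a) * x) ((b ∸ a) * y) cross) ⟩
          R * ∣ r a - r b ∣                     ≡⟨ *-distribˡ-∣-∣ R (r a) (r b) ⟩
          ∣ R * r a - R * r b ∣                 ≤⟨ <⇒≤ (m/n≡o/n⇒∣m-o∣<n (R * r a) (R * r b) x eq) ⟩
          x                                     ∎
          where open ≤-Reasoning

      lastWindow : ∀ {a} → a ≤ Q → window a ≡ Q → Approx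
      lastWindow {zero} _ eq = ⊥-elim (<⇒≢ 1≤Q (sym (trans (sym eq) window0≡0)))
        where
        window0≡0 : window 0 ≡ 0
        window0≡0 = begin
          R * r 0 / x ≡⟨ cong (λ c → R * c / x) (n≤0⇒n≡0 (m%n≤m 0 x)) ⟩
          R * 0 / x   ≡⟨ cong (_/ x) (*-zeroʳ R) ⟩
          0 / x       ≡⟨ 0/n≡0 x ⟩
          0           ∎
          where open ≡-Reasoning
      lastWindow {a@(suc _)} a≤Q eq = suc (d a) , a , s≤s z≤n , a≤Q , close
        where
        cross : suc (d a) * x + r a ≡ a * y + x
        cross = begin
          x + d a * x + r a    ≡⟨ regroup x (d a * x) (r a) ⟩
          r a + d a * x + x    ≡⟨ cong (_+ x) (sym (m≡m%n+[m/n]*n (a * y) x)) ⟩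
          a * y + x            ∎
          where
          open ≡-Reasoning
          regroup : ∀ x t s → x + t + s ≡ s + t + x
          regroup = solve-∀
        Qx≤Rr : Q * x ≤ R * r a
        Qx≤Rr = subst (λ c → c * x ≤ R * r a) eq (m/n*n≤m (R * r a) x)
        close : R * ∣ suc (d a) * x - a * y ∣ ≤ x
        close = begin
          R * ∣ suc (d a) * x - a * y ∣ ≡⟨ cong (R *_) (m+n≡o+p⇒∣m-o∣≡∣p-n∣ (suc (d a) * x) (a * y) cross) ⟩
          R * ∣ x - r a ∣               ≡⟨ cong (R *_) (m≤n⇒∣n-m∣≡n∸m (<⇒≤ (m%n<n (a * y) x))) ⟩
          R * (x ∸ r a)                 ≡⟨ *-distribˡ-∸ R x (r a) ⟩
          R * x ∸ R * r a               ≤⟨ m≤n+o⇒m∸n≤o (R * x) (R * r a)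
                                             (subst (R * x ≤_) (+-comm x (R * r a)) (+-monoʳ-≤ x Qx≤Rr)) ⟩
          x                             ∎
          where open ≤-Reasoning

      slot : ℕ → ℕ
      slot j with j ≤? Q
      ... | yes _ = window j
      ... | no  _ = Q

      slot<R : ∀ j → slot j < R
      slot<R j with j ≤? Q
      ... | yes _ = window<R j
      ... | no  _ = ≤-refl

      slot-≤ : ∀ {j} → j ≤ Q → slot j ≡ window j
      slot-≤ {j} j≤Q with j ≤? Q
      ... | yes _   = refl
      ... | no  j≰Q = ⊥-elim (j≰Q j≤Q)

      slot-> : ∀ {j} → ¬ j ≤ Q → slot j ≡ Q
      slot-> {j} j≰Q with j ≤? Q
      ... | yes j≤Q = ⊥-elim (j≰Q j≤Q)
      ... | no  _   = refl

      collide : ∀ {i j} → i < j → j ≤ R → Dec (j ≤ Q) → slot i ≡ slot j → Approx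
      collide {i} {j} i<j _ (yes j≤Q) eq =
        sameWindow i<j j≤Q (trans (sym (slot-≤ (≤-trans (<⇒≤ i<j) j≤Q))) (trans eq (slot-≤ j≤Q)))
      collide {i} {j} i<j j≤R (no j≰Q) eq =
        lastWindow i≤Q (trans (sym (slot-≤ i≤Q)) (trans eq (slot-> j≰Q)))
        where
        i≤Q : i ≤ Q
        i≤Q = s≤s⁻¹ (<-≤-trans i<j j≤R)

    dirichlet : ∃₂ λ p q → 1 ≤ q × q ≤ Q × suc Q * ∣ p * x - q * y ∣ ≤ x
    dirichlet with pigeonhole ≤-refl (λ i → fromℕ< (slot<R (toℕ i)))
    ... | i , j , i<j , same = collide i<j (s≤s⁻¹ (toℕ<n j)) (toℕ j ≤? Q)
                                 (fromℕ<-injective _ _ (slot<R (toℕ i)) (slot<R (toℕ j)) same)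

module SmallCase where

  open import Data.Nat
  open import Data.Nat.Properties
  open import Data.Bool using (Bool; true; false; T; _∧_; _∨_; not)
  open import Data.Bool.Properties using (T-∧; T-∨)
  open import Data.Product using (_×_; _,_; proj₁; proj₂)
  open import Data.Sum using (_⊎_; inj₁; inj₂; [_,_]′)
  open import Data.Empty using (⊥; ⊥-elim)
  open import Data.Unit using (tt)
  open import Function using (_∘_)
  open import Function.Bundles using (Equivalence)
  open import Relation.Binary.PropositionalEquality
  open import Relation.Nullary using (yes; no)

  isqrt-search : (fuel n lo hi : ℕ) → ℕ
  isqrt-search zero n lo hi = lo
  isqrt-search (suc fuel) n lo hi with suc lo <ᵇ hi
  ... | false = lo
  ... | true with n <ᵇ (lo + hi) / 2 * ((lo + hi) / 2)
  ...   | true  = isqrt-search fuel n lo ((lo + hi) / 2)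
  ...   | false = isqrt-search fuel n ((lo + hi) / 2) hi

  isqrt : ℕ → ℕ
  isqrt n = isqrt-search 64 n 0 (suc n)

  nearMiss : ℕ → ℕ → Bool
  nearMiss x y = (0 <ᵇ d) ∧ (d ^ 2 <ᵇ x)
    where d = ∣ x ^ 3 - y ^ 2 ∣′

  farBelow : ℕ → ℕ → Bool
  farBelow x t = x ≤ᵇ (x ^ 3 ∸ t ^ 2) ^ 2

  farAbove : ℕ → ℕ → Bool
  farAbove x t = x ≤ᵇ (t ^ 2 ∸ x ^ 3) ^ 2

  is23 : ℕ → ℕ → Bool
  is23 x y = (x ≡ᵇ 2) ∧ (y ≡ᵇ 3)

  -- Only y = s and y = s + 1, with s = isqrt (x³), can be near misses: farBelow and farAbove certify
  -- that all other y are too far from x^(3/2), so isqrt needs no correctness proof.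
  certified : ℕ → Bool
  certified x = farBelow x (pred s) ∧ farAbove x (s + 2)
              ∧ (not (nearMiss x s) ∨ is23 x s) ∧ (not (nearMiss x (suc s)) ∨ is23 x (suc s))
    where s = isqrt (x ^ 3)

  certifiedUpTo : ℕ → Bool
  certifiedUpTo zero    = true
  certifiedUpTo (suc n) = certified (suc n) ∧ certifiedUpTo n

  certifiedUpTo-4095 : T (certifiedUpTo 4095)
  certifiedUpTo-4095 = tt

  module _ {x y : ℕ} (close : ∣ x ^ 3 - y ^ 2 ∣ ^ 2 < x) where

    private
      far⇒¬close : ∀ {d} → x ≤ d ^ 2 → d ≤ ∣ x ^ 3 - y ^ 2 ∣ → ⊥
      far⇒¬close x≤d² d≤ = <-irrefl refl (<-≤-trans close (≤-trans x≤d² (^-monoˡ-≤ 2 d≤)))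

    farBelow⇒< : ∀ {t} → T (farBelow x t) → t < y
    farBelow⇒< {t} cert = ≰⇒> λ y≤t → far⇒¬close (≤ᵇ⇒≤ x _ cert)
      (≤-trans (∸-monoʳ-≤ (x ^ 3) (^-monoˡ-≤ 2 y≤t)) (m∸n≤∣m-n∣ (x ^ 3) (y ^ 2)))

    farAbove⇒> : ∀ {t} → T (farAbove x t) → y < t
    farAbove⇒> {t} cert = ≰⇒> λ t≤y → far⇒¬close (≤ᵇ⇒≤ x _ cert)
      (≤-trans (∸-monoˡ-≤ (x ^ 3) (^-monoˡ-≤ 2 t≤y))
               (subst (y ^ 2 ∸ x ^ 3 ≤_) (∣-∣-comm (y ^ 2) (x ^ 3)) (m∸n≤∣m-n∣ (y ^ 2) (x ^ 3))))

  nearMiss-complete : ∀ {x y} → 0 < ∣ x ^ 3 - y ^ 2 ∣ → ∣ x ^ 3 - y ^ 2 ∣ ^ 2 < x →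
                      T (nearMiss x y)
  nearMiss-complete {x} {y} pos close
    rewrite sym (∣-∣≡∣-∣′ (x ^ 3) (y ^ 2)) = Equivalence.from T-∧ (<⇒<ᵇ pos , <⇒<ᵇ close)

  private
    pred<⇒≤ : ∀ {m n} → pred m < n → m ≤ n
    pred<⇒≤ {zero}  _ = z≤n
    pred<⇒≤ {suc m} h = h

    pred<∧<+2 : ∀ {m n} → pred m < n → n < m + 2 → n ≡ m ⊎ n ≡ suc m
    pred<∧<+2 {m} {n} lo hi with n ≟ m
    ... | yes n≡m = inj₁ n≡m
    ... | no  n≢m = inj₂ (≤-antisym (s≤s⁻¹ (subst (n <_) (+-comm m 2) hi))
                                    (≤∧≢⇒< (pred<⇒≤ lo) (n≢m ∘ sym)))

    T-∧⁻ : ∀ {a b} → T (a ∧ b) → T a × T b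
    T-∧⁻ = Equivalence.to T-∧

    T-not-elim : ∀ {b} → T (not b) → T b → ⊥
    T-not-elim {true} () _

  certified-sound : ∀ {x y} → T (certified x) → 0 < ∣ x ^ 3 - y ^ 2 ∣ →
                    ∣ x ^ 3 - y ^ 2 ∣ ^ 2 < x → x ≡ 2 × y ≡ 3
  certified-sound {x} {y} cert pos close =
    [ (λ y≡s → resolve {s} y≡s onS) , (λ y≡s+1 → resolve {suc s} y≡s+1 onS+1) ]′
      (pred<∧<+2 {s} (farBelow⇒< {x} {y} close below) (farAbove⇒> {x} {y} close above))
    where
    s = isqrt (x ^ 3)
    b₁ = farBelow x (pred s)
    b₂ = farAbove x (s + 2)
    b₃ = not (nearMiss x s) ∨ is23 x s
    b₄ = not (nearMiss x (suc s)) ∨ is23 x (suc s)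
    below : T b₁
    below = proj₁ (T-∧⁻ {b₁} cert)
    above : T b₂
    above = proj₁ (T-∧⁻ {b₂} (proj₂ (T-∧⁻ {b₁} cert)))
    onS : T b₃
    onS = proj₁ (T-∧⁻ {b₃} (proj₂ (T-∧⁻ {b₂} (proj₂ (T-∧⁻ {b₁} cert)))))
    onS+1 : T b₄
    onS+1 = proj₂ (T-∧⁻ {b₃} (proj₂ (T-∧⁻ {b₂} (proj₂ (T-∧⁻ {b₁} cert)))))
    resolve : ∀ {z} → y ≡ z → T (not (nearMiss x z) ∨ is23 x z) → x ≡ 2 × y ≡ 3
    resolve refl h with Equivalence.to T-∨ h
    ... | inj₁ notNear = ⊥-elim (T-not-elim notNear (nearMiss-complete {x} {y} pos close))
    ... | inj₂ h23 = ≡ᵇ⇒≡ x 2 (proj₁ (T-∧⁻ {x ≡ᵇ 2} h23)) , ≡ᵇ⇒≡ y 3 (proj₂ (T-∧⁻ {x ≡ᵇ 2} h23))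

  certifiedUpTo-sound : ∀ n {x} → T (certifiedUpTo n) → 1 ≤ x → x ≤ n → T (certified x)
  certifiedUpTo-sound zero    _    1≤x x≤0 = ⊥-elim (<-irrefl refl (≤-trans 1≤x x≤0))
  certifiedUpTo-sound (suc n) {x} cert 1≤x x≤n+1 with x ≟ suc n
  ... | yes refl = proj₁ (T-∧⁻ {certified (suc n)} cert)
  ... | no  x≢n+1 = certifiedUpTo-sound n (proj₂ (T-∧⁻ {certified (suc n)} cert)) 1≤x (s≤s⁻¹ (≤∧≢⇒< x≤n+1 x≢n+1))

  nearMiss<4096⇒2,3 : ∀ {x y} → 1 ≤ x → x < 4096 → 0 < ∣ x ^ 3 - y ^ 2 ∣ →
                      ∣ x ^ 3 - y ^ 2 ∣ ^ 2 < x → x ≡ 2 × y ≡ 3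
  nearMiss<4096⇒2,3 1≤x x<4096 =
    certified-sound (certifiedUpTo-sound 4095 certifiedUpTo-4095 1≤x (s≤s⁻¹ x<4096))

open import Data.Nat as ℕ using (ℕ; zero; suc; z≤n; s≤s)
import Data.Nat.Properties as ℕₚ
import Data.Nat.Tactic.RingSolver as ℕ-Solver
open import Data.Integer using (ℤ; +_; -[1+_]; _-_; _*_; _^_; ∣_∣; _<_; _≤_; +<+)
open import Data.Integer.Properties using (pos-*; m-n≡m⊖n; ∣⊖∣-≤; ∣m⊖n∣≡∣n⊖m∣; ∣i*j∣≡∣i∣*∣j∣)
open import Data.Vec using ([]; _∷_)
open import Data.Product using (∃; ∃₂; ∃-syntax; _×_; _,_; proj₁; proj₂)
open import Data.Empty using (⊥-elim)
open import Data.Sum using (inj₁; inj₂)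
open import Relation.Binary.PropositionalEquality
open import Relation.Nullary using (Dec; yes; no; ¬_)
open import Defs
open SignedSums
open Identities
open SizeEstimates
open RationalRoot
open CubicSign
open Dirichlet
open SmallCase

∣+m-+n∣≡∣m-n∣ : ∀ m n → ∣ + m - + n ∣ ≡ ℕ.∣ m - n ∣
∣+m-+n∣≡∣m-n∣ m n with ℕₚ.≤-total m n
... | inj₁ m≤n = trans (cong ∣_∣ (m-n≡m⊖n m n)) (trans (∣⊖∣-≤ m≤n) (sym (ℕₚ.m≤n⇒∣m-n∣≡n∸m m≤n)))
... | inj₂ n≤m = trans (cong ∣_∣ (m-n≡m⊖n m n)) (trans (∣m⊖n∣≡∣n⊖m∣ m n)
                   (trans (∣⊖∣-≤ n≤m) (sym (ℕₚ.m≤n⇒∣n-m∣≡n∸m n≤m))))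

pos-^ : ∀ n k → (+ n) ^ k ≡ + (n ℕ.^ k)
pos-^ n zero    = refl
pos-^ n (suc k) = trans (cong (+ n *_) (pos-^ n k)) (sym (pos-* n (n ℕ.^ k)))

between-powers : ∀ e n {x} → 1 ℕ.≤ x → x ℕ.≤ suc n ℕ.^ suc e →
                 ∃ λ m → m ℕ.^ suc e ℕ.< x × x ℕ.≤ suc m ℕ.^ suc e
between-powers e zero    1≤x x≤1 = 0 , 1≤x , x≤1
between-powers e (suc n) {x} 1≤x x≤ with x ℕₚ.≤? suc n ℕ.^ suc e
... | yes x≤′ = between-powers e n 1≤x x≤′
... | no  x≰  = suc n , ℕₚ.≰⇒> x≰ , x≤

*-cancelˡ-≤-+ : ∀ {q a b c} → 1 ℕ.≤ q → q ℕ.* a ℕ.≤ q ℕ.* b ℕ.+ c → a ℕ.≤ b ℕ.+ c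
*-cancelˡ-≤-+ {q} {a} {b} {c} 1≤q qa≤qb+c = ℕₚ.≮⇒≥ λ b+c<a → ℕₚ.<-irrefl refl (begin-strict
  q ℕ.* b ℕ.+ c                ≤⟨ ℕₚ.+-monoʳ-≤ (q ℕ.* b) (ℕₚ.m≤n*m c q {{ℕ.>-nonZero 1≤q}}) ⟩
  q ℕ.* b ℕ.+ q ℕ.* c          <⟨ ℕₚ.+-monoʳ-< (q ℕ.* b) (ℕₚ.m<m+n (q ℕ.* c) 1≤q) ⟩
  q ℕ.* b ℕ.+ (q ℕ.* c ℕ.+ q)  ≡⟨ e q b c ⟩
  q ℕ.* suc (b ℕ.+ c)          ≤⟨ ℕₚ.*-monoʳ-≤ q b+c<a ⟩
  q ℕ.* a                      ≤⟨ qa≤qb+c ⟩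
  q ℕ.* b ℕ.+ c                ∎)
  where
  open ℕₚ.≤-Reasoning
  e : ∀ q b c → q ℕ.* b ℕ.+ (q ℕ.* c ℕ.+ q) ≡ q ℕ.* suc (b ℕ.+ c)
  e = ℕ-Solver.solve-∀

∣k∣≡∣x³-y²∣ : ∀ {x y k} → GoodTriplet x y k → ∣ k ∣ ≡ ℕ.∣ x ℕ.^ 3 - y ℕ.^ 2 ∣
∣k∣≡∣x³-y²∣ {x} {y} t = trans (cong ∣_∣ (GoodTriplet.k-def t))
  (trans (cong₂ (λ a b → ∣ a - b ∣) (pos-^ x 3) (pos-^ y 2)) (∣+m-+n∣≡∣m-n∣ (x ℕ.^ 3) (y ℕ.^ 2)))

Conclusion : ℕ → ℕ → ℕ → ℕ → Set
Conclusion x y p q = 1 ℕ.≤ p × 1 ℕ.≤ q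
  × ((p ℕ.∸ 1) ℕ.^ 3 ℕ.< x ℕ.^ 2)
  × (q <RootOf 6) x
  × (+ 0 < C q p x y)
  × ((C q p x y - + 1) ^ 6 < + (729 ℕ.* q ℕ.^ 6 ℕ.* x))
  × (∣ F q p x y ∣ ℕ.< 8 ℕ.* q ℕ.+ 1)
  × (∣ H q p x y ∣ ℕ.< 72 ℕ.* q ℕ.^ 4 ℕ.+ 1)

module LargeX {x y : ℕ} {k : ℤ} (t : GoodTriplet x y k) (4096≤x : 4096 ℕ.≤ x) where

  open GoodTriplet t

  private
    κ = ∣ k ∣

    y²≤x³+κ : y ℕ.^ 2 ℕ.≤ x ℕ.^ 3 ℕ.+ κ
    y²≤x³+κ = subst (λ d → y ℕ.^ 2 ℕ.≤ x ℕ.^ 3 ℕ.+ d) (sym (∣k∣≡∣x³-y²∣ t)) (ℕₚ.m≤n+∣n-m∣ (y ℕ.^ 2) (x ℕ.^ 3))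

    x³≤y²+κ : x ℕ.^ 3 ℕ.≤ y ℕ.^ 2 ℕ.+ κ
    x³≤y²+κ = subst (λ d → x ℕ.^ 3 ℕ.≤ y ℕ.^ 2 ℕ.+ d) (sym (∣k∣≡∣x³-y²∣ t)) (ℕₚ.m≤n+∣m-n∣ (x ℕ.^ 3) (y ℕ.^ 2))

  module Approximation {p q R : ℕ} (1≤q : 1 ℕ.≤ q) (q<R : q ℕ.< R) (x≤R⁶ : x ℕ.≤ R ℕ.^ 6) (q⁶<x : q ℕ.^ 6 ℕ.< x)
                       (Rα≤x : R ℕ.* ℕ.∣ p ℕ.* x - q ℕ.* y ∣ ℕ.≤ x) where

    private
      α = ℕ.∣ p ℕ.* x - q ℕ.* y ∣
      Aₚ = A p q x y

    open Estimates x y q R α κ 4096≤x 1≤q q<R x≤R⁶ q⁶<x Rα≤x k-small y²≤x³+κ x³≤y²+κ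

    ∣A∣≡α : ∣ Aₚ ∣ ≡ α
    ∣A∣≡α = trans (cong₂ (λ a b → ∣ a - b ∣) (sym (pos-* p x)) (sym (pos-* q y))) (∣+m-+n∣≡∣m-n∣ (p ℕ.* x) (q ℕ.* y))

    px≤qy+α : p ℕ.* x ℕ.≤ q ℕ.* y ℕ.+ α
    px≤qy+α = ℕₚ.m≤n+∣m-n∣ (p ℕ.* x) (q ℕ.* y)

    qy≤px+α : q ℕ.* y ℕ.≤ p ℕ.* x ℕ.+ α
    qy≤px+α = ℕₚ.m≤n+∣n-m∣ (q ℕ.* y) (p ℕ.* x)

    x^n∣v∣≤evalAbs : ∀ n {v} terms → (+ x) ^ n * v ≡ eval terms (Aₚ ∷ + q ∷ + y ∷ k ∷ []) →
                     x ℕ.^ n ℕ.* ∣ v ∣ ℕ.≤ evalAbs terms (α ∷ q ∷ y ∷ κ ∷ [])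
    x^n∣v∣≤evalAbs n {v} terms eq = begin
      x ℕ.^ n ℕ.* ∣ v ∣                     ≡⟨ cong (ℕ._* ∣ v ∣) (cong ∣_∣ (pos-^ x n)) ⟨
      ∣ (+ x) ^ n ∣ ℕ.* ∣ v ∣               ≡⟨ ∣i*j∣≡∣i∣*∣j∣ ((+ x) ^ n) v ⟨
      ∣ (+ x) ^ n * v ∣                      ≡⟨ cong ∣_∣ eq ⟩
      ∣ eval terms (Aₚ ∷ + q ∷ + y ∷ k ∷ []) ∣ ≤⟨ ∣eval∣≤evalAbs terms (Aₚ ∷ + q ∷ + y ∷ k ∷ []) ⟩
      evalAbs terms (∣ Aₚ ∣ ∷ q ∷ y ∷ κ ∷ []) ≡⟨ cong (λ a → evalAbs terms (a ∷ q ∷ y ∷ κ ∷ [])) ∣A∣≡α ⟩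
      evalAbs terms (α ∷ q ∷ y ∷ κ ∷ [])     ∎
      where open ℕₚ.≤-Reasoning

    ∣F∣<8q+1 : ∣ F q p x y ∣ ℕ.< 8 ℕ.* q ℕ.+ 1
    ∣F∣<8q+1 = F-bound ∣ F q p x y ∣
      (x^n∣v∣≤evalAbs 4 F-terms (trans (x⁴F≡Fᴬ p q x y) (cong (Fᴬ Aₚ (+ q) (+ y)) (sym k-def))))

    ∣H∣<72q⁴+1 : ∣ H q p x y ∣ ℕ.< 72 ℕ.* q ℕ.^ 4 ℕ.+ 1
    ∣H∣<72q⁴+1 = H-bound ∣ H q p x y ∣
      (x^n∣v∣≤evalAbs 6 H-terms (trans (x⁶H≡Hᴬ p q x y) (cong (Hᴬ Aₚ (+ q) (+ y)) (sym k-def))))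

    x³C≡Cᴬ[k] : (+ x) ^ 3 * C q p x y ≡ Cᴬ Aₚ (+ q) (+ y) k
    x³C≡Cᴬ[k] = trans (x³C≡Cᴬ p q x y) (cong (Cᴬ Aₚ (+ q) (+ y)) (sym k-def))

    C≢0 : C q p x y ≢ + 0
    C≢0 C≡0 = ℕₚ.<⇒≢ k-nz (sym (trans (cong ∣_∣ k-def) k≡0))
      where
      root = rational-root-integral {p} {q} {x} {y} 1≤q (C≡0⇒root q p x y C≡0)
      m = proj₁ root
      mx≤y+α : m ℕ.* x ℕ.≤ y ℕ.+ α
      mx≤y+α = *-cancelˡ-≤-+ 1≤q (subst (ℕ._≤ q ℕ.* y ℕ.+ α) (trans (cong (ℕ._* x) (proj₁ (proj₂ root))) (e m q x)) px≤qy+α)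
        where e : ∀ m q x → m ℕ.* q ℕ.* x ≡ q ℕ.* (m ℕ.* x)
              e = ℕ-Solver.solve-∀
      k≡0 : ∣ (+ x) ^ 3 - (+ y) ^ 2 ∣ ≡ 0
      k≡0 = integral-root⇒k≡0 {m} {x} {y} (proj₂ (proj₂ root))
              (subst (λ d → m ℕ.* m ℕ.+ 4 ℕ.* d ℕ.< 4 ℕ.* x) (cong ∣_∣ k-def) (m²+4κ<4x m mx≤y+α))

    0≤C : + 0 ≤ C q p x y
    0≤C = Cᴬ≡n*c⇒0≤c Aₚ k q y (x ℕ.^ 3)
      (subst (ℕ._≤ 3 ℕ.* q ℕ.* y) (sym ∣A∣≡α) α≤3qy)
      (subst₂ ℕ._<_ (cong (λ a → q ℕ.* q ℕ.* κ ℕ.* (3 ℕ.* a ℕ.+ q ℕ.* y)) (sym ∣A∣≡α)) (sym (^3≡ x)) q²κ[3α+qy]<x³)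
      (trans (sym x³C≡Cᴬ[k]) (cong (_* C q p x y) (pos-^ x 3)))

    C-positive-and-bounded : ∀ c → C q p x y ≡ c → + 0 < c × (c - + 1) ^ 6 < + (729 ℕ.* q ℕ.^ 6 ℕ.* x)
    C-positive-and-bounded (+ zero)  C≡0 = ⊥-elim (C≢0 C≡0)
    C-positive-and-bounded -[1+ n ]  C≡  = ⊥-elim (+0≰-[1+n] (subst (+ 0 ≤_) C≡ 0≤C))
      where
      +0≰-[1+n] : ¬ (+ 0 ≤ -[1+ n ])
      +0≰-[1+n] ()
    C-positive-and-bounded (+ suc u) C≡  = +<+ (s≤s z≤n) , subst (_< _) (sym (pos-^ u 6)) (+<+ (C-bound u x³[u+1]≤Cbound))
      where
      x³[u+1]≤Cbound : x ℕ.^ 3 ℕ.* suc u ℕ.≤ Cbound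
      x³[u+1]≤Cbound = begin
        x ℕ.^ 3 ℕ.* suc u              ≡⟨ cong (λ c → ∣ c ∣ ℕ.* suc u) (pos-^ x 3) ⟨
        ∣ (+ x) ^ 3 ∣ ℕ.* ∣ + suc u ∣  ≡⟨ ∣i*j∣≡∣i∣*∣j∣ ((+ x) ^ 3) (+ suc u) ⟨
        ∣ (+ x) ^ 3 * + suc u ∣        ≡⟨ cong (λ c → ∣ (+ x) ^ 3 * c ∣) C≡ ⟨
        ∣ (+ x) ^ 3 * C q p x y ∣      ≡⟨ cong ∣_∣ x³C≡Cᴬ[k] ⟩
        ∣ Cᴬ Aₚ (+ q) (+ y) k ∣        ≤⟨ ∣Cᴬ∣≤ Aₚ k q y ⟩
        ∣ Aₚ ∣ ℕ.* ∣ Aₚ ∣ ℕ.* (∣ Aₚ ∣ ℕ.+ 3 ℕ.* q ℕ.* y) ℕ.+ q ℕ.* q ℕ.* κ ℕ.* (3 ℕ.* ∣ Aₚ ∣ ℕ.+ q ℕ.* y)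
                                       ≡⟨ cong (λ a → a ℕ.* a ℕ.* (a ℕ.+ 3 ℕ.* q ℕ.* y) ℕ.+ q ℕ.* q ℕ.* κ ℕ.* (3 ℕ.* a ℕ.+ q ℕ.* y)) ∣A∣≡α ⟩
        Cbound                         ∎
        where open ℕₚ.≤-Reasoning

    conclusion : Conclusion x y p q
    conclusion = p-positive p qy≤px+α , 1≤q , [p-1]³<x² p px≤qy+α , q⁶<x ,
                 proj₁ C-facts , proj₂ C-facts , ∣F∣<8q+1 , ∣H∣<72q⁴+1
      where C-facts = C-positive-and-bounded (C q p x y) refl

Conclusion-2-3-1-1 : Conclusion 2 3 1 1
Conclusion-2-3-1-1 = ℕₚ.≤-refl , ℕₚ.≤-refl , s≤s z≤n , s≤s ℕₚ.≤-refl , +<+ (s≤s z≤n) , +<+ (s≤s z≤n) ,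
                     s≤s (s≤s z≤n) , literal {18} {73}

small-x : ∀ {x y k} → GoodTriplet x y k → x ℕ.< 4096 → ∃[ p ] ∃[ q ] Conclusion x y p q
small-x {x} {y} t x<4096 = only-2-3 (nearMiss<4096⇒2,3 x-pos x<4096
  (subst (0 ℕ.<_) (∣k∣≡∣x³-y²∣ t) k-nz) (subst (λ d → d ℕ.^ 2 ℕ.< x) (∣k∣≡∣x³-y²∣ t) k-small))
  where
  open GoodTriplet t
  only-2-3 : x ≡ 2 × y ≡ 3 → ∃[ p ] ∃[ q ] Conclusion x y p q
  only-2-3 (refl , refl) = 1 , 1 , Conclusion-2-3-1-1

large-x : ∀ {x y k} → GoodTriplet x y k → 4096 ℕ.≤ x → ∃[ p ] ∃[ q ] Conclusion x y p q
large-x {x} {y} t 4096≤x = from-sixth-root (between-powers 5 x (ℕₚ.≤-trans (s≤s z≤n) 4096≤x) x≤[1+x]⁶)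
  where
  x≤[1+x]⁶ : x ℕ.≤ suc x ℕ.^ 6
  x≤[1+x]⁶ = ℕₚ.≤-trans (ℕₚ.n≤1+n x) (ℕₚ.m≤m*n (suc x) (suc x ℕ.^ 5) {{ℕₚ.m^n≢0 (suc x) 5}})
  from-sixth-root : (∃ λ Q → Q ℕ.^ 6 ℕ.< x × x ℕ.≤ suc Q ℕ.^ 6) → ∃[ p ] ∃[ q ] Conclusion x y p q
  from-sixth-root (zero   , _    , x≤1)      = ⊥-elim (ℕₚ.<⇒≱ (ℕₚ.≤-trans (s≤s (s≤s z≤n)) 4096≤x) x≤1)
  from-sixth-root (suc Q′ , Q⁶<x , x≤[Q+1]⁶) = from-approximation (dirichlet x y (suc Q′) {{ℕ.>-nonZero (ℕₚ.≤-trans (s≤s z≤n) 4096≤x)}} (s≤s z≤n))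
    where
    from-approximation : (∃₂ λ p q → 1 ℕ.≤ q × q ℕ.≤ suc Q′ × suc (suc Q′) ℕ.* ℕ.∣ p ℕ.* x - q ℕ.* y ∣ ℕ.≤ x) →
                         ∃[ p ] ∃[ q ] Conclusion x y p q
    from-approximation (p , q , 1≤q , q≤Q , close) =
      p , q , LargeX.Approximation.conclusion t 4096≤x 1≤q (s≤s q≤Q) x≤[Q+1]⁶ (ℕₚ.≤-<-trans (ℕₚ.^-monoˡ-≤ 6 q≤Q) Q⁶<x) close

theorem2p4 : (x y : ℕ) (k : ℤ) → GoodTriplet x y k →
    ∃[ p ] ∃[ q ] (1 ℕ.≤ p × 1 ℕ.≤ q
    × ((p ℕ.∸ 1) ℕ.^ 3 ℕ.< x ℕ.^ 2)
    × (q <RootOf 6) x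
    × (+ 0 < C q p x y)
    × ((C q p x y - + 1) ^ 6 < + (729 ℕ.* q ℕ.^ 6 ℕ.* x))
    × (∣ F q p x y ∣ ℕ.< 8 ℕ.* q ℕ.+ 1)
    × (∣ H q p x y ∣ ℕ.< 72 ℕ.* q ℕ.^ 4 ℕ.+ 1))
theorem2p4 x y k t = by-size (x ℕₚ.<? 4096)
  where
  by-size : Dec (x ℕ.< 4096) → ∃[ p ] ∃[ q ] Conclusion x y p q
  by-size (yes x<4096) = small-x t x<4096
  by-size (no  x≮4096) = large-x t (ℕₚ.≮⇒≥ x≮4096)
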